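{- Suppose we have a commuting diagram of $!$-graph monomorphisms $L \xleftarrow{i_1} I \xrightarrow{i_2} R$, $m : L \rightarrow G$, $d : I \rightarrow D$, $r : R\rightarrow H$, $g : D \rightarrow G$, $h : D \rightarrow H$ with $m \circ i_1 = g\circ d$ and $r\circ i_2 = h\circ d$, in which both squares are pushouts, where $L \xleftarrow{i_1} I \xrightarrow{i_2} R$ is a $!$-graph rewrite rule and $m$ is not required to be a $!$-graph matching. If $U(G)$ has no isolated vertices, then there is a subgraph $J$ of $D$ such that $G \xleftarrow{g|_J} J \xrightarrow{h|_J} H$ is a $!$-graph rewrite rule.
   Context: Fix a compressed monoidal signature $T=(O,M,\mathrm{dom},\mathrm{cod})$, $\mathrm{dom},\mathrm{cod}: M \rightarrow (O\times\{\mathsf{v},\mathsf{f}\})^*$. The derived compressed typegraph $\mathcal{G}_T$ has vertex set $O\sqcup M$, a self-loop on each $X\in O$, an edge $\mathrm{in}^a_{f,i}$ from $X$ to $f$ for each $f\in M$ and index $i$ with $\mathrm{dom}(f)[i]=(X,a)$, and an edge $\mathrm{out}^a_{f,j}$ from $f$ to $X$ for each index $j$ with $\mathrm{cod}(f)[j]=(X,a)$. $\mathcal{G}_{T!}$ is $\mathcal{G}_T$ plus a vertex $!$, a self-loop on $!$, and an edge from $!$ to each vertex of $\mathcal{G}_T$. For a finite directed multigraph $G$ typed over $\mathcal{G}_{T!}$, vertices typed in $O$, $M$, $!$ are wire-, node-, $!$-vertices; fixed-arity edges are those typed by an $\mathsf{f}$-tagged edge; $U$ deletes $!$-vertices and incident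 edges. A string graph is a $\mathcal{G}_T$-typed graph whose typing restricts at each node-vertex to a bijection on incident fixed-arity edges and whose wire-vertices have at most one incoming and one outgoing edge; inputs (outputs) are wire-vertices with no incoming (outgoing) edge. An open subgraph $O'$ of a string graph $K$ is a string subgraph with no vertex adjacent to a wire-vertex outside $O'$ and no incident fixed-arity edge outside $O'$. $B(b)$ is the full subgraph on successors of a $!$-vertex $b$, $\beta(G)$ the full subgraph on $!$-vertices. A $!$-graph is a $\mathcal{G}_{T!}$-typed graph with $U(G)$ a string graph, $\beta(G)$ posetal (at most one edge between two vertices, edge relation a partial order), $U(B(b))$ open in $U(G)$ for each $!$-vertex $b$, and $B(b')\subseteq B(b)$ whenever $b'\in B(b)$; morphisms are typed graph morphisms, and pushouts are taken in the category of $\mathcal{G}_{T!}$-typed graphs. $\mathrm{In}_!(G)$ (resp. $\mathrm{Out}_!(G)$) is the full subgraph on the $!$-vertices and the inputs (resp. outputs) of $U(G)$; $\mathrm{Bound}_!(G)$ has vertices the $!$-vertices and the inputs and outputs of $U(G)$, and edges those from a $!$-vertex to one of these vertices. A $!$-graph rewrite rule is a span $L\xleftarrow{i_1} I \xrightarrow{i_2} R$ of $!$-graph morphisms such that $U(L),U(R)$ have no isolated wire-vertices and there are isomorphisms $\phi_I:\mathrm{In}_!(L)\cong\mathrm{In}_!(R)$, $\phi_O:\mathrm{Out}_!(L)\cong\mathrm{Out}_!(R)$, $\phi_L:\mathrm{Bound}_!(L)\cong I$, $\phi_R:\mathrm{Bound}_!(R)\cong I$ such that, with $j_1 = \phi_L\circ(\mathrm{In}_!(L)\hookrightarrow\mathrm{Bound}_!(L))$,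 $j_2 = \phi_R\circ(\mathrm{In}_!(R)\hookrightarrow \mathrm{Bound}_!(R))$ and $k_1,k_2$ defined likewise with $\mathrm{Out}_!$, the maps $i_1\circ j_1$, $i_2\circ j_2$, $i_1\circ k_1$, $i_2\circ k_2$ are the respective inclusions into $L$ and $R$, and $j_2\circ\phi_I=j_1$, $k_2\circ\phi_O=k_1$. -}

module Defs where

open import Level using (Level)
open import Data.Nat using (ℕ)
open import Data.Fin using (Fin)
open import Data.List using (List; length; lookup)
open import Data.Product using (Σ; Σ-syntax; _×_; _,_; proj₁; proj₂)
open import Data.Sum using (_⊎_; inj₁; inj₂)
open import Data.Unit using (⊤; tt)
open import Data.Empty using (⊥; ⊥-elim)
open import Relation.Nullary using (¬_)
open import Relation.Binary.PropositionalEquality using (_≡_; refl; sym; trans; subst; cong)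
open import Relation.Binary.Structures using (IsPartialOrder)
open import Function.Bundles using (_↔_)
open import Function.Definitions using (Injective)
open import Data.Irrelevant using (Irrelevant; [_])
open import Data.Refinement using (Refinement; _,_; value; proof)

data Tag : Set where
  vTag fTag : Tag   -- the tags v (variable arity) and f (fixed arity)

record Signature : Set₁ where
  field
    O   : Set
    M   : Set
    dom : M → List (O × Tag)
    cod : M → List (O × Tag)

module _ (T : Signature) where
  open Signature T

  -- The typegraph G_{T!}  (G_T is the part not involving `bang`)

  data TV : Set where
    ob   : O → TV
    mor  : M → TV
    bang : TV

  data TE : Set where
    loopO : O → TE
    inE   : (f : M) → Fin (length (dom f)) → TE
    outE  : (f : M) → Fin (length (cod f)) → TE
    loopB : TE
    bangO : O → TE
    bangM : M → TE

  tsrc : TE → TV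
  tsrc (loopO X) = ob X
  tsrc (inE f i) = ob (proj₁ (lookup (dom f) i))
  tsrc (outE f j) = mor f
  tsrc loopB = bang
  tsrc (bangO X) = bang
  tsrc (bangM f) = bang

  ttgt : TE → TV
  ttgt (loopO X) = ob X
  ttgt (inE f i) = mor f
  ttgt (outE f j) = ob (proj₁ (lookup (cod f) j))
  ttgt loopB = bang
  ttgt (bangO X) = ob X
  ttgt (bangM f) = mor f

  isBangT : TV → Set
  isBangT bang = ⊤
  isBangT _    = ⊥

  isWireT : TV → Set
  isWireT (ob _) = ⊤
  isWireT _      = ⊥

  isNodeT : TV → Set
  isNodeT (mor _) = ⊤
  isNodeT _       = ⊥

  fixedT : TE → Set
  fixedT (inE f i)  = proj₂ (lookup (dom f) i) ≡ fTag
  fixedT (outE f j) = proj₂ (lookup (cod f) j) ≡ fTag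
  fixedT _          = ⊥

  record TGraph : Set₁ where
    field
      V      : Set
      E      : Set
      src    : E → V
      tgt    : E → V
      τV     : V → TV
      τE     : E → TE
      src-ok : ∀ e → tsrc (τE e) ≡ τV (src e)
      tgt-ok : ∀ e → ttgt (τE e) ≡ τV (tgt e)

  open TGraph public

  IsFinite : TGraph → Set
  IsFinite G = (Σ[ n ∈ ℕ ] (V G ↔ Fin n)) × (Σ[ n ∈ ℕ ] (E G ↔ Fin n))

  record Hom (A B : TGraph) : Set where
    field
      vmap     : V A → V B
      emap     : E A → E B
      src-pres : ∀ e → src B (emap e) ≡ vmap (src A e)
      tgt-pres : ∀ e → tgt B (emap e) ≡ vmap (tgt A e)
      τV-pres  : ∀ v → τV B (vmap v) ≡ τV A v
      τE-pres  : ∀ e → τE B (emap e) ≡ τE A e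

  open Hom public

  idH : {A : TGraph} → Hom A A
  idH = record { vmap = λ v → v ; emap = λ e → e
               ; src-pres = λ _ → refl ; tgt-pres = λ _ → refl
               ; τV-pres = λ _ → refl ; τE-pres = λ _ → refl }

  infixr 9 _∘H_
  _∘H_ : {A B C : TGraph} → Hom B C → Hom A B → Hom A C
  _∘H_ {A} {B} {C} g f = record
    { vmap = λ v → vmap g (vmap f v)
    ; emap = λ e → emap g (emap f e)
    ; src-pres = λ e → trans (src-pres g (emap f e)) (cong (vmap g) (src-pres f e))
    ; tgt-pres = λ e → trans (tgt-pres g (emap f e)) (cong (vmap g) (tgt-pres f e))
    ; τV-pres = λ v → trans (τV-pres g (vmap f v)) (τV-pres f v)
    ; τE-pres = λ e → trans (τE-pres g (emap f e)) (τE-pres f e) }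

  infix 4 _≈H_
  _≈H_ : {A B : TGraph} → Hom A B → Hom A B → Set
  f ≈H g = (∀ v → vmap f v ≡ vmap g v) × (∀ e → emap f e ≡ emap g e)

  Mono : {A B : TGraph} → Hom A B → Set
  Mono f = Injective _≡_ _≡_ (vmap f) × Injective _≡_ _≡_ (emap f)

  record Iso (A B : TGraph) : Set where
    field
      to      : Hom A B
      from    : Hom B A
      from∘to : from ∘H to ≈H idH
      to∘from : to ∘H from ≈H idH

  open Iso public

  -- pushout square  A --f--> B, A --g--> C, B --p--> P, C --q--> P
  -- in the category of (finite) G_{T!}-typed graphs
  IsPushout : {A B C P : TGraph} → Hom A B → Hom A C → Hom B P → Hom C P → Set₁
  IsPushout {A} {B} {C} {P} f g p q =
    (p ∘H f ≈H q ∘H g) ×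
    ((Q : TGraph) → IsFinite Q → (a : Hom B Q) (b : Hom C Q) → a ∘H f ≈H b ∘H g →
      Σ[ u ∈ Hom P Q ] ((u ∘H p ≈H a) × (u ∘H q ≈H b) ×
        ((u' : Hom P Q) → u' ∘H p ≈H a → u' ∘H q ≈H b → u' ≈H u)))

  fullSub : (G : TGraph) → (V G → Set) → TGraph
  fullSub G P = record
    { V = Refinement (V G) P
    ; E = Refinement (E G) (λ e → P (src G e) × P (tgt G e))
    ; src = λ e → src G (value e) , Data.Irrelevant.map proj₁ (proof e)
    ; tgt = λ e → tgt G (value e) , Data.Irrelevant.map proj₂ (proof e)
    ; τV = λ v → τV G (value v)
    ; τE = λ e → τE G (value e)
    ; src-ok = λ e → src-ok G (value e)
    ; tgt-ok = λ e → tgt-ok G (value e) }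

  fullIncl : (G : TGraph) (P : V G → Set) → Hom (fullSub G P) G
  fullIncl G P = record
    { vmap = value ; emap = value
    ; src-pres = λ _ → refl ; tgt-pres = λ _ → refl
    ; τV-pres = λ _ → refl ; τE-pres = λ _ → refl }

  NotBang : (G : TGraph) → V G → Set
  NotBang G v = ¬ isBangT (τV G v)

  IsBang : (G : TGraph) → V G → Set
  IsBang G v = isBangT (τV G v)

  U : TGraph → TGraph
  U G = fullSub G (NotBang G)

  isInput : (K : TGraph) → V K → Set
  isInput K w = isWireT (τV K w) × (∀ e → ¬ (tgt K e ≡ w))

  isOutput : (K : TGraph) → V K → Set
  isOutput K w = isWireT (τV K w) × (∀ e → ¬ (src K e ≡ w))

  Incident : (K : TGraph) → E K → V K → Set
  Incident K e n = (src K e ≡ n) ⊎ (tgt K e ≡ n)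

  TIncident : TE → TV → Set
  TIncident t x = (tsrc t ≡ x) ⊎ (ttgt t ≡ x)

  record IsStringGraph (K : TGraph) : Set where
    field
      noBang    : ∀ v → ¬ isBangT (τV K v)
      node-inj  : ∀ n → isNodeT (τV K n) → ∀ e e' → Incident K e n → Incident K e' n →
                  fixedT (τE K e) → τE K e ≡ τE K e' → e ≡ e'
      node-surj : ∀ n → isNodeT (τV K n) → ∀ t → fixedT t → TIncident t (τV K n) →
                  Σ[ e ∈ E K ] (Incident K e n × τE K e ≡ t)
      wire-in   : ∀ w → isWireT (τV K w) → ∀ e e' → tgt K e ≡ w → tgt K e' ≡ w → e ≡ e'
      wire-out  : ∀ w → isWireT (τV K w) → ∀ e e' → src K e ≡ w → src K e' ≡ w → e ≡ e'

  record IsOpenFullSubgraph (K : TGraph) (P : V K → Set) : Set where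
    field
      string     : IsStringGraph (fullSub K P)
      wire-closed-out : ∀ e → P (src K e) → isWireT (τV K (tgt K e)) → P (tgt K e)
      wire-closed-in  : ∀ e → P (tgt K e) → isWireT (τV K (src K e)) → P (src K e)
      fixed-closed : ∀ e → fixedT (τE K e) → P (src K e) ⊎ P (tgt K e) →
                     P (src K e) × P (tgt K e)

  Succ : (G : TGraph) → V G → V G → Set
  Succ G b v = Σ[ e ∈ E G ] (src G e ≡ b × tgt G e ≡ v)

  β : TGraph → TGraph
  β G = fullSub G (IsBang G)

  EdgeRel : (K : TGraph) → V K → V K → Set
  EdgeRel K x y = Σ[ e ∈ E K ] (src K e ≡ x × tgt K e ≡ y)

  IsPosetal : TGraph → Set
  IsPosetal K = (∀ e e' → src K e ≡ src K e' → tgt K e ≡ tgt K e' → e ≡ e')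
              × IsPartialOrder _≡_ (EdgeRel K)

  record IsBangGraph (G : TGraph) : Set where
    field
      finite  : IsFinite G
      string  : IsStringGraph (U G)
      posetal : IsPosetal (β G)
      open-B  : ∀ b → IsBang G b → IsOpenFullSubgraph (U G) (λ v → Succ G b (value v))
      -- b' ∈ B(b) implies B(b') ⊆ B(b)  (full subgraphs: vertex inclusion)
      nested  : ∀ b b' → IsBang G b → IsBang G b' → Succ G b b' →
                ∀ v → Succ G b' v → Succ G b v

  InP : (G : TGraph) → V G → Set
  InP G v = IsBang G v ⊎ Σ[ nb ∈ NotBang G v ] isInput (U G) (v , [ nb ])

  OutP : (G : TGraph) → V G → Set
  OutP G v = IsBang G v ⊎ Σ[ nb ∈ NotBang G v ] isOutput (U G) (v , [ nb ])

  BoundP : (G : TGraph) → V G → Set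
  BoundP G v = IsBang G v ⊎
    Σ[ nb ∈ NotBang G v ] (isInput (U G) (v , [ nb ]) ⊎ isOutput (U G) (v , [ nb ]))

  In! : TGraph → TGraph
  In! G = fullSub G (InP G)

  Out! : TGraph → TGraph
  Out! G = fullSub G (OutP G)

  Bound! : TGraph → TGraph
  Bound! G = record
    { V = Refinement (V G) (BoundP G)
    ; E = Refinement (E G) (λ e → IsBang G (src G e) × BoundP G (src G e) × BoundP G (tgt G e))
    ; src = λ e → src G (value e) , Data.Irrelevant.map (λ p → proj₁ (proj₂ p)) (proof e)
    ; tgt = λ e → tgt G (value e) , Data.Irrelevant.map (λ p → proj₂ (proj₂ p)) (proof e)
    ; τV = λ v → τV G (value v)
    ; τE = λ e → τE G (value e)
    ; src-ok = λ e → src-ok G (value e)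
    ; tgt-ok = λ e → tgt-ok G (value e) }

  private
    tgtBang⇒srcBang : ∀ t → isBangT (ttgt t) → isBangT (tsrc t)
    tgtBang⇒srcBang loopB _ = tt
    tgtBang⇒srcBang (loopO _) ()
    tgtBang⇒srcBang (inE _ _) ()
    tgtBang⇒srcBang (outE _ _) ()
    tgtBang⇒srcBang (bangO _) ()
    tgtBang⇒srcBang (bangM _) ()

    edgeIntoBang : (G : TGraph) (e : E G) → IsBang G (tgt G e) → IsBang G (src G e)
    edgeIntoBang G e b = subst isBangT (src-ok G e)
      (tgtBang⇒srcBang (τE G e) (subst isBangT (sym (tgt-ok G e)) b))

    inEdgeSrcBang : (G : TGraph) (e : E G) → InP G (src G e) → InP G (tgt G e) → IsBang G (src G e)
    inEdgeSrcBang G e (inj₁ b) _ = b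
    inEdgeSrcBang G e (inj₂ (nb , _)) (inj₁ bt) = ⊥-elim (nb (edgeIntoBang G e bt))
    inEdgeSrcBang G e (inj₂ (nb , _)) (inj₂ (nb' , _ , noIn)) =
      ⊥-elim (noIn (e , [ nb , nb' ]) refl)

    outEdgeSrcBang : (G : TGraph) (e : E G) → OutP G (src G e) → OutP G (tgt G e) → IsBang G (src G e)
    outEdgeSrcBang G e (inj₁ b) _ = b
    outEdgeSrcBang G e (inj₂ (nb , _)) (inj₁ bt) = ⊥-elim (nb (edgeIntoBang G e bt))
    outEdgeSrcBang G e (inj₂ (nb , _ , noOut)) (inj₂ (nb' , _)) =
      ⊥-elim (noOut (e , [ nb , nb' ]) refl)

    InP⇒BoundP : (G : TGraph) (v : V G) → InP G v → BoundP G v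
    InP⇒BoundP G v (inj₁ b) = inj₁ b
    InP⇒BoundP G v (inj₂ (nb , i)) = inj₂ (nb , inj₁ i)

    OutP⇒BoundP : (G : TGraph) (v : V G) → OutP G v → BoundP G v
    OutP⇒BoundP G v (inj₁ b) = inj₁ b
    OutP⇒BoundP G v (inj₂ (nb , o)) = inj₂ (nb , inj₂ o)

  InInclBound : (G : TGraph) → Hom (In! G) (Bound! G)
  InInclBound G = record
    { vmap = λ v → value v , Data.Irrelevant.map (InP⇒BoundP G (value v)) (proof v)
    ; emap = λ e → value e , Data.Irrelevant.map
        (λ p → inEdgeSrcBang G (value e) (proj₁ p) (proj₂ p)
             , InP⇒BoundP G _ (proj₁ p) , InP⇒BoundP G _ (proj₂ p)) (proof e)
    ; src-pres = λ _ → refl ; tgt-pres = λ _ → refl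
    ; τV-pres = λ _ → refl ; τE-pres = λ _ → refl }

  OutInclBound : (G : TGraph) → Hom (Out! G) (Bound! G)
  OutInclBound G = record
    { vmap = λ v → value v , Data.Irrelevant.map (OutP⇒BoundP G (value v)) (proof v)
    ; emap = λ e → value e , Data.Irrelevant.map
        (λ p → outEdgeSrcBang G (value e) (proj₁ p) (proj₂ p)
             , OutP⇒BoundP G _ (proj₁ p) , OutP⇒BoundP G _ (proj₂ p)) (proof e)
    ; src-pres = λ _ → refl ; tgt-pres = λ _ → refl
    ; τV-pres = λ _ → refl ; τE-pres = λ _ → refl }

  InIncl : (G : TGraph) → Hom (In! G) G
  InIncl G = fullIncl G (InP G)

  OutIncl : (G : TGraph) → Hom (Out! G) G
  OutIncl G = fullIncl G (OutP G)

  NoIsolatedWire : TGraph → Set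
  NoIsolatedWire K = ∀ w → isWireT (τV K w) → Σ[ e ∈ E K ] Incident K e w

  NoIsolated : TGraph → Set
  NoIsolated K = ∀ w → Σ[ e ∈ E K ] Incident K e w

  record IsRewriteRule {L I R : TGraph} (i₁ : Hom I L) (i₂ : Hom I R) : Set where
    field
      bangL  : IsBangGraph L
      bangI  : IsBangGraph I
      bangR  : IsBangGraph R
      noIsoL : NoIsolatedWire (U L)
      noIsoR : NoIsolatedWire (U R)
      φI     : Iso (In! L) (In! R)
      φO     : Iso (Out! L) (Out! R)
      φL     : Iso (Bound! L) I
      φR     : Iso (Bound! R) I
    j₁ : Hom (In! L) I
    j₁ = to φL ∘H InInclBound L
    j₂ : Hom (In! R) I
    j₂ = to φR ∘H InInclBound R
    k₁ : Hom (Out! L) I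
    k₁ = to φL ∘H OutInclBound L
    k₂ : Hom (Out! R) I
    k₂ = to φR ∘H OutInclBound R
    field
      i₁j₁ : i₁ ∘H j₁ ≈H InIncl L
      i₂j₂ : i₂ ∘H j₂ ≈H InIncl R
      i₁k₁ : i₁ ∘H k₁ ≈H OutIncl L
      i₂k₂ : i₂ ∘H k₂ ≈H OutIncl R
      j₂φI : j₂ ∘H to φI ≈H j₁
      k₂φO : k₂ ∘H to φO ≈H k₁

module Submission where

open import Defs
open import Data.Bool using (Bool; true)
open import Data.Empty using (⊥; ⊥-elim; ⊥-elim-irr)
open import Data.Fin using (Fin; zero; suc)
import Data.Fin as Fin
open import Data.Fin.Properties using (any?; *↔×; 2↔Bool)
open import Data.Irrelevant using (Irrelevant; [_])
import Data.Irrelevant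
open import Data.Nat using (ℕ; zero; suc; _*_)
open import Data.Product using (Σ; Σ-syntax; _×_; _,_; proj₁; proj₂)
open import Data.Product.Function.NonDependent.Propositional using (_×-↔_)
open import Data.Refinement using (Refinement; _,_; value; proof)
open import Data.Refinement.Properties using (value-injective)
open import Data.Sum using (_⊎_; inj₁; inj₂)
import Data.Sum
open import Data.Unit using (tt)
open import Function.Bundles using (_↔_; Inverse; mk↔ₛ′)
open import Function.Definitions using (Injective)
open import Function.Properties.Inverse using (↔-sym; ↔-trans; ↔⇒↣)
open import Relation.Binary.Definitions using (DecidableEquality)
open import Relation.Binary.PropositionalEquality
  using (_≡_; refl; sym; trans; cong; cong₂; subst; isEquivalence; module ≡-Reasoning)
open import Relation.Binary.Structures using (IsPartialOrder)
open import Relation.Nullary using (¬_; Dec; yes; no; does)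
open import Relation.Nullary.Decidable
  using (map′; via-injection; dec-true; _×-dec_; _⊎-dec_; ¬?; recompute)
open ≡-Reasoning

Finite : Set → Set
Finite A = Σ[ n ∈ ℕ ] (A ↔ Fin n)

irrelevant-¬ : {A : Set} → .(¬ A) → ¬ A
irrelevant-¬ ¬a a = ⊥-elim-irr (¬a a)

does⇒witness : {A : Set} (a? : Dec A) → does a? ≡ true → A
does⇒witness (yes a) _ = a

module FiniteType {A : Set} (finA : Finite A) where
  private
    open module I = Inverse (proj₂ finA) using (strictlyInverseʳ) renaming (to to forth; from to back)

  _≟_ : DecidableEquality A
  _≟_ = via-injection (↔⇒↣ (proj₂ finA)) Fin._≟_

  any?-finite : {P : A → Set} → (∀ a → Dec (P a)) → Dec (Σ A P)
  any?-finite {P} P? = map′ (λ (i , p) → back i , p)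
                            (λ (a , p) → forth a , subst P (sym (strictlyInverseʳ a)) p)
                            (any? (λ i → P? (back i)))

subset-Fin-finite : ∀ n {P : Fin n → Set} → (∀ i → Dec (P i)) → Finite (Refinement (Fin n) P)
subset-Fin-finite zero P? = 0 , mk↔ₛ′ (λ { (() , _) }) (λ ()) (λ ()) (λ { (() , _) })
subset-Fin-finite (suc n) {P} P? with subset-Fin-finite n (λ i → P? (suc i)) | P? zero
... | k , rest | yes p₀ = suc k , mk↔ₛ′ forth back forth∘back back∘forth
  where
  open Inverse rest using () renaming (to to to′; from to from′)
  forth : Refinement (Fin (suc n)) P → Fin (suc k)
  forth (zero , _) = zero
  forth (suc i , [ p ]) = suc (to′ (i , [ p ]))
  back : Fin (suc k) → Refinement (Fin (suc n)) P
  back zero = zero , [ p₀ ]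
  back (suc j) = suc (value (from′ j)) , proof (from′ j)
  forth∘back : ∀ j → forth (back j) ≡ j
  forth∘back zero = refl
  forth∘back (suc j) = cong suc (Inverse.strictlyInverseˡ rest j)
  back∘forth : ∀ x → back (forth x) ≡ x
  back∘forth (zero , _) = refl
  back∘forth (suc i , [ p ]) =
    value-injective (cong (λ z → suc (value z)) (Inverse.strictlyInverseʳ rest (i , [ p ])))
... | k , rest | no ¬p₀ = k , mk↔ₛ′ forth back forth∘back back∘forth
  where
  open Inverse rest using () renaming (to to to′; from to from′)
  forth : Refinement (Fin (suc n)) P → Fin k
  forth (zero , [ p ]) = ⊥-elim-irr (¬p₀ p)
  forth (suc i , [ p ]) = to′ (i , [ p ])
  back : Fin k → Refinement (Fin (suc n)) P
  back j = suc (value (from′ j)) , proof (from′ j)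
  forth∘back : ∀ j → forth (back j) ≡ j
  forth∘back = Inverse.strictlyInverseˡ rest
  back∘forth : ∀ x → back (forth x) ≡ x
  back∘forth (zero , [ p ]) = ⊥-elim-irr (¬p₀ p)
  back∘forth (suc i , [ p ]) =
    value-injective (cong (λ z → suc (value z)) (Inverse.strictlyInverseʳ rest (i , [ p ])))

refinement-finite : {A : Set} → Finite A → {P : A → Set} → (∀ a → Dec (P a)) →
                    Finite (Refinement A P)
refinement-finite (n , A↔Fin) {P} P? =
  let k , sub = subset-Fin-finite n (λ i → P? (back i)) in k , ↔-trans restrict sub
  where
  open Inverse A↔Fin using (strictlyInverseˡ; strictlyInverseʳ) renaming (to to forth; from to back)
  restrict : Refinement _ P ↔ Refinement (Fin n) (λ i → P (back i))
  restrict = mk↔ₛ′ (λ { (a , [ p ]) → forth a , [ subst P (sym (strictlyInverseʳ a)) p ] })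
                   (λ { (i , [ p ]) → back i , [ p ] })
                   (λ { (i , _) → value-injective (strictlyInverseˡ i) })
                   (λ { (a , _) → value-injective (strictlyInverseʳ a) })

×-finite : {A B : Set} → Finite A → Finite B → Finite (A × B)
×-finite (n , f) (m , g) = n * m , ↔-trans (f ×-↔ g) (↔-sym *↔×)

Bool-finite : Finite Bool
Bool-finite = 2 , ↔-sym 2↔Bool

module _ (T : Signature) where
  open Signature T

  infixr 9 _∘_
  _∘_ : {A B C : TGraph T} → Hom T B C → Hom T A B → Hom T A C
  _∘_ = _∘H_ T

  infix 4 _≈_
  _≈_ : {A B : TGraph T} → Hom T A B → Hom T A B → Set
  _≈_ = _≈H_ T

  wire⇒¬bang : ∀ t → isWireT T t → ¬ isBangT T t
  wire⇒¬bang (ob _) _ ()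

  wire⇒¬node : ∀ t → isWireT T t → ¬ isNodeT T t
  wire⇒¬node (ob _) _ ()

  bang⇒¬node : ∀ t → isBangT T t → ¬ isNodeT T t
  bang⇒¬node bang _ ()

  bang? : ∀ t → Dec (isBangT T t)
  bang? (ob _) = no λ ()
  bang? (mor _) = no λ ()
  bang? bang = yes tt

  wire? : ∀ t → Dec (isWireT T t)
  wire? (ob _) = yes tt
  wire? (mor _) = no λ ()
  wire? bang = no λ ()

  -- The only type-edge ending at ! is its self-loop, so an edge into a
  -- !-vertex starts at a !-vertex.
  into-bang : ∀ t → isBangT T (ttgt T t) → isBangT T (tsrc T t)
  into-bang loopB _ = tt
  into-bang (loopO _) ()
  into-bang (inE _ _) ()
  into-bang (outE _ _) ()
  into-bang (bangO _) ()
  into-bang (bangM _) ()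

  edge-into-bang : (K : TGraph T) (e : E K) → IsBang T K (tgt K e) → IsBang T K (src K e)
  edge-into-bang K e b = subst (isBangT T) (src-ok K e)
    (into-bang (τE K e) (subst (isBangT T) (sym (tgt-ok K e)) b))

  Wire : (K : TGraph T) → V K → Set
  Wire K v = isWireT T (τV K v)

  module _ {A B : TGraph T} (f : Hom T A B) where
    type-to : (P : TV T → Set) → ∀ v → P (τV A v) → P (τV B (vmap f v))
    type-to P v = subst P (sym (τV-pres f v))

    type-from : (P : TV T → Set) → ∀ v → P (τV B (vmap f v)) → P (τV A v)
    type-from P v = subst P (τV-pres f v)

  NotBangT : TV T → Set
  NotBangT t = ¬ isBangT T t

  module _ {A B : TGraph T} (f : Hom T A B) where
    notBang-src : ∀ e → NotBang T A (src A e) → NotBang T B (src B (emap f e))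
    notBang-src e nb = subst (NotBang T B) (sym (src-pres f e)) (type-to f NotBangT (src A e) nb)

    notBang-tgt : ∀ e → NotBang T A (tgt A e) → NotBang T B (tgt B (emap f e))
    notBang-tgt e nb = subst (NotBang T B) (sym (tgt-pres f e)) (type-to f NotBangT (tgt A e) nb)

    notBang-src⁻ : ∀ e → NotBang T B (src B (emap f e)) → NotBang T A (src A e)
    notBang-src⁻ e nb = type-from f NotBangT (src A e) (subst (NotBang T B) (src-pres f e) nb)

    notBang-tgt⁻ : ∀ e → NotBang T B (tgt B (emap f e)) → NotBang T A (tgt A e)
    notBang-tgt⁻ e nb = type-from f NotBangT (tgt A e) (subst (NotBang T B) (tgt-pres f e) nb)

  Incoming : (K : TGraph T) → V K → Set
  Incoming K v = Σ[ e ∈ E K ] (NotBang T K (src K e) × tgt K e ≡ v)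

  Outgoing : (K : TGraph T) → V K → Set
  Outgoing K v = Σ[ e ∈ E K ] (NotBang T K (tgt K e) × src K e ≡ v)

  -- Inputs and outputs of U(K), phrased directly on K with a relevant proof.
  IsIn : (K : TGraph T) → V K → Set
  IsIn K v = Wire K v × ¬ Incoming K v

  IsOut : (K : TGraph T) → V K → Set
  IsOut K v = Wire K v × ¬ Outgoing K v

  InR : (K : TGraph T) → V K → Set
  InR K v = IsBang T K v ⊎ IsIn K v

  OutR : (K : TGraph T) → V K → Set
  OutR K v = IsBang T K v ⊎ IsOut K v

  BoundR : (K : TGraph T) → V K → Set
  BoundR K v = IsBang T K v ⊎ (IsIn K v ⊎ IsOut K v)

  module _ (K : TGraph T) where
    wire⇒notBang : ∀ v → Wire K v → NotBang T K v
    wire⇒notBang v = wire⇒¬bang (τV K v)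

    input⇒IsIn : ∀ v .(nb : NotBang T K v) → isInput T (U T K) (v , [ nb ]) → IsIn K v
    input⇒IsIn v nb (w , noIn) = w , λ (e , nbs , eq) →
      noIn (e , [ nbs , subst (NotBang T K) (sym eq) (wire⇒notBang v w) ]) (value-injective eq)

    IsIn⇒input : ∀ v .(nb : NotBang T K v) → IsIn K v → isInput T (U T K) (v , [ nb ])
    IsIn⇒input v nb (w , noIn) =
      w , λ { (e , [ p ]) eq → noIn (e , irrelevant-¬ (proj₁ p) , cong value eq) }

    output⇒IsOut : ∀ v .(nb : NotBang T K v) → isOutput T (U T K) (v , [ nb ]) → IsOut K v
    output⇒IsOut v nb (w , noOut) = w , λ (e , nbt , eq) →
      noOut (e , [ subst (NotBang T K) (sym eq) (wire⇒notBang v w) , nbt ]) (value-injective eq)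

    IsOut⇒output : ∀ v .(nb : NotBang T K v) → IsOut K v → isOutput T (U T K) (v , [ nb ])
    IsOut⇒output v nb (w , noOut) =
      w , λ { (e , [ p ]) eq → noOut (e , irrelevant-¬ (proj₂ p) , cong value eq) }

    InP⇒InR : ∀ v → InP T K v → InR K v
    InP⇒InR v (inj₁ b) = inj₁ b
    InP⇒InR v (inj₂ (nb , i)) = inj₂ (input⇒IsIn v nb i)

    InR⇒InP : ∀ v → InR K v → InP T K v
    InR⇒InP v (inj₁ b) = inj₁ b
    InR⇒InP v (inj₂ i) = inj₂ (wire⇒notBang v (proj₁ i) , IsIn⇒input v _ i)

    OutP⇒OutR : ∀ v → OutP T K v → OutR K v
    OutP⇒OutR v (inj₁ b) = inj₁ b
    OutP⇒OutR v (inj₂ (nb , o)) = inj₂ (output⇒IsOut v nb o)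

    OutR⇒OutP : ∀ v → OutR K v → OutP T K v
    OutR⇒OutP v (inj₁ b) = inj₁ b
    OutR⇒OutP v (inj₂ o) = inj₂ (wire⇒notBang v (proj₁ o) , IsOut⇒output v _ o)

    BoundP⇒BoundR : ∀ v → BoundP T K v → BoundR K v
    BoundP⇒BoundR v (inj₁ b) = inj₁ b
    BoundP⇒BoundR v (inj₂ (nb , inj₁ i)) = inj₂ (inj₁ (input⇒IsIn v nb i))
    BoundP⇒BoundR v (inj₂ (nb , inj₂ o)) = inj₂ (inj₂ (output⇒IsOut v nb o))

    BoundR⇒BoundP : ∀ v → BoundR K v → BoundP T K v
    BoundR⇒BoundP v (inj₁ b) = inj₁ b
    BoundR⇒BoundP v (inj₂ (inj₁ i)) = inj₂ (wire⇒notBang v (proj₁ i) , inj₁ (IsIn⇒input v _ i))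
    BoundR⇒BoundP v (inj₂ (inj₂ o)) = inj₂ (wire⇒notBang v (proj₁ o) , inj₂ (IsOut⇒output v _ o))

  module _ {A B : TGraph T} (f : Hom T A B) where
    Incoming-along : ∀ x → Incoming A x → Incoming B (vmap f x)
    Incoming-along x (e , nbs , eq) = emap f e , notBang-src f e nbs , trans (tgt-pres f e) (cong (vmap f) eq)

    Outgoing-along : ∀ x → Outgoing A x → Outgoing B (vmap f x)
    Outgoing-along x (e , nbt , eq) = emap f e , notBang-tgt f e nbt , trans (src-pres f e) (cong (vmap f) eq)

    IsIn-reflect : ∀ x → IsIn B (vmap f x) → IsIn A x
    IsIn-reflect x (w , noIn) = type-from f (isWireT T) x w , λ inc → noIn (Incoming-along x inc)

    IsOut-reflect : ∀ x → IsOut B (vmap f x) → IsOut A x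
    IsOut-reflect x (w , noOut) = type-from f (isWireT T) x w , λ out → noOut (Outgoing-along x out)

    BoundR-reflect : ∀ x → BoundR B (vmap f x) → BoundR A x
    BoundR-reflect x (inj₁ b) = inj₁ (type-from f (isBangT T) x b)
    BoundR-reflect x (inj₂ (inj₁ i)) = inj₂ (inj₁ (IsIn-reflect x i))
    BoundR-reflect x (inj₂ (inj₂ o)) = inj₂ (inj₂ (IsOut-reflect x o))

  module _ {A B : TGraph T} (f : Hom T A B) where
    Incoming-pullback : ∀ {v} (inc : Incoming B v) e → emap f e ≡ proj₁ inc →
                        NotBang T A (src A e) × vmap f (tgt A e) ≡ v
    Incoming-pullback (e₀ , nbs , tgt≡) e fe≡e₀ =
        notBang-src⁻ f e (subst (λ e′ → NotBang T B (src B e′)) (sym fe≡e₀) nbs)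
      , trans (sym (tgt-pres f e)) (trans (cong (tgt B) fe≡e₀) tgt≡)

    Outgoing-pullback : ∀ {v} (out : Outgoing B v) e → emap f e ≡ proj₁ out →
                        NotBang T A (tgt A e) × vmap f (src A e) ≡ v
    Outgoing-pullback (e₀ , nbt , src≡) e fe≡e₀ =
        notBang-tgt⁻ f e (subst (λ e′ → NotBang T B (tgt B e′)) (sym fe≡e₀) nbt)
      , trans (sym (src-pres f e)) (trans (cong (src B) fe≡e₀) src≡)

  module _ (K : TGraph T) where
    InP⇒BoundP : ∀ v → InP T K v → BoundP T K v
    InP⇒BoundP v (inj₁ b) = inj₁ b
    InP⇒BoundP v (inj₂ (nb , i)) = inj₂ (nb , inj₁ i)

    OutP⇒BoundP : ∀ v → OutP T K v → BoundP T K v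
    OutP⇒BoundP v (inj₁ b) = inj₁ b
    OutP⇒BoundP v (inj₂ (nb , o)) = inj₂ (nb , inj₂ o)

    -- An edge between two vertices of In!(K) (resp. Out!(K)) starts at a
    -- !-vertex: inputs have no incoming edges, outputs no outgoing ones.
    In-edge-from-bang : ∀ e → InR K (src K e) → InR K (tgt K e) → IsBang T K (src K e)
    In-edge-from-bang e (inj₁ bs) _ = bs
    In-edge-from-bang e (inj₂ (ws , _)) (inj₁ bt) = ⊥-elim (wire⇒notBang K _ ws (edge-into-bang K e bt))
    In-edge-from-bang e (inj₂ (ws , _)) (inj₂ (_ , noIn)) = ⊥-elim (noIn (e , wire⇒notBang K _ ws , refl))

    Out-edge-from-bang : ∀ e → OutR K (src K e) → OutR K (tgt K e) → IsBang T K (src K e)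
    Out-edge-from-bang e (inj₁ bs) _ = bs
    Out-edge-from-bang e (inj₂ (ws , _)) (inj₁ bt) = ⊥-elim (wire⇒notBang K _ ws (edge-into-bang K e bt))
    Out-edge-from-bang e (inj₂ (_ , noOut)) (inj₂ (wt , _)) = ⊥-elim (noOut (e , wire⇒notBang K _ wt , refl))

  -- Relevant input/output proofs at a wire-vertex from irrelevant membership
  -- in In!, Out! or Bound!; for Bound!, an incoming (outgoing) edge decides
  -- on which side of the boundary the vertex lies.
  module _ (K : TGraph T) where
    wire-output : ∀ v → Wire K v → .(OutP T K v) → IsOut K v
    wire-output v w op = w , λ out → ⊥-elim-irr (refute (OutP⇒OutR K v op) out)
      where
      refute : OutR K v → Outgoing K v → ⊥
      refute (inj₁ b) _ = wire⇒¬bang _ w b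
      refute (inj₂ (_ , noOut)) = noOut

    wire-input : ∀ v → Wire K v → .(InP T K v) → IsIn K v
    wire-input v w ip = w , λ inc → ⊥-elim-irr (refute (InP⇒InR K v ip) inc)
      where
      refute : InR K v → Incoming K v → ⊥
      refute (inj₁ b) _ = wire⇒¬bang _ w b
      refute (inj₂ (_ , noIn)) = noIn

    incoming-boundary-wire⇒IsOut : ∀ v → Wire K v → Irrelevant (BoundP T K v) → Incoming K v → IsOut K v
    incoming-boundary-wire⇒IsOut v w [ bp ] inc = w , λ out → ⊥-elim-irr (refute (BoundP⇒BoundR K v bp) out)
      where
      refute : BoundR K v → Outgoing K v → ⊥
      refute (inj₁ b) _ = wire⇒¬bang _ w b
      refute (inj₂ (inj₁ (_ , noIn))) _ = noIn inc
      refute (inj₂ (inj₂ (_ , noOut))) = noOut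

    outgoing-boundary-wire⇒IsIn : ∀ v → Wire K v → Irrelevant (BoundP T K v) → Outgoing K v → IsIn K v
    outgoing-boundary-wire⇒IsIn v w [ bp ] out = w , λ inc → ⊥-elim-irr (refute (BoundP⇒BoundR K v bp) inc)
      where
      refute : BoundR K v → Incoming K v → ⊥
      refute (inj₁ b) _ = wire⇒¬bang _ w b
      refute (inj₂ (inj₁ (_ , noIn))) = noIn
      refute (inj₂ (inj₂ (_ , noOut))) _ = noOut out

    module _ (noIso : NoIsolatedWire T (U T K)) where
      IsOut⇒Incoming : ∀ v → IsOut K v → Incoming K v
      IsOut⇒Incoming v (w , noOut) with noIso (v , [ wire⇒notBang K v w ]) w
      ... | (e , [ p ]) , inj₁ src≡ = ⊥-elim (noOut (e , irrelevant-¬ (proj₂ p) , cong value src≡))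
      ... | (e , [ p ]) , inj₂ tgt≡ = e , irrelevant-¬ (proj₁ p) , cong value tgt≡

      IsIn⇒Outgoing : ∀ v → IsIn K v → Outgoing K v
      IsIn⇒Outgoing v (w , noIn) with noIso (v , [ wire⇒notBang K v w ]) w
      ... | (e , [ p ]) , inj₁ src≡ = e , irrelevant-¬ (proj₂ p) , cong value src≡
      ... | (e , [ p ]) , inj₂ tgt≡ = ⊥-elim (noIn (e , irrelevant-¬ (proj₁ p) , cong value tgt≡))

  -- An edge of U(K) at v: an edge between non-! vertices with an endpoint at v.
  -- It is carried along morphisms and, through a mono, pulled back.
  Touching : (K : TGraph T) → V K → Set
  Touching K v = Σ[ e ∈ E K ] ((NotBang T K (src K e) × NotBang T K (tgt K e)) × (src K e ≡ v ⊎ tgt K e ≡ v))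

  module _ (K : TGraph T) where
    U-incident⇒Touching : ∀ v .(nb : NotBang T K v) →
                          Σ[ e ∈ E (U T K) ] Incident T (U T K) e (v , [ nb ]) → Touching K v
    U-incident⇒Touching v nb ((e , [ p ]) , inc) =
      e , (irrelevant-¬ (proj₁ p) , irrelevant-¬ (proj₂ p)) , Data.Sum.map (cong value) (cong value) inc

    Touching⇒U-incident : ∀ v .(nb : NotBang T K v) → Touching K v →
                          Σ[ e ∈ E (U T K) ] Incident T (U T K) e (v , [ nb ])
    Touching⇒U-incident v nb (e , (nbs , nbt) , at) =
      (e , [ nbs , nbt ]) , Data.Sum.map value-injective value-injective at

  module _ {A B : TGraph T} (f : Hom T A B) where
    Touching-along : ∀ x → Touching A x → Touching B (vmap f x)
    Touching-along x (e , (nbs , nbt) , at) = emap f e , (notBang-src f e nbs , notBang-tgt f e nbt) ,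
      Data.Sum.map (λ s≡ → trans (src-pres f e) (cong (vmap f) s≡))
                   (λ t≡ → trans (tgt-pres f e) (cong (vmap f) t≡)) at

    Touching-endpoint : ∀ {v} (t : Touching B v) e → emap f e ≡ proj₁ t →
                        Σ[ x ∈ V A ] vmap f x ≡ v
    Touching-endpoint (_ , _ , inj₁ s≡) e fe≡ =
      src A e , trans (sym (src-pres f e)) (trans (cong (src B) fe≡) s≡)
    Touching-endpoint (_ , _ , inj₂ t≡) e fe≡ =
      tgt A e , trans (sym (tgt-pres f e)) (trans (cong (tgt B) fe≡) t≡)

    Touching-pullback : Mono T f → ∀ {y} (t : Touching B (vmap f y)) e → emap f e ≡ proj₁ t → Touching A y
    Touching-pullback mono-f (e₀ , (nbs , nbt) , at) e fe≡e₀ =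
      e , (notBang-src⁻ f e (subst (λ e′ → NotBang T B (src B e′)) (sym fe≡e₀) nbs)
          , notBang-tgt⁻ f e (subst (λ e′ → NotBang T B (tgt B e′)) (sym fe≡e₀) nbt))
        , Data.Sum.map (λ s≡ → proj₁ mono-f (trans (sym (src-pres f e)) (trans (cong (src B) fe≡e₀) s≡)))
                       (λ t≡ → proj₁ mono-f (trans (sym (tgt-pres f e)) (trans (cong (tgt B) fe≡e₀) t≡))) at

  module FiniteGraph (K : TGraph T) (finK : IsFinite T K) where
    open FiniteType (proj₁ finK) public using () renaming (_≟_ to _≟V_; any?-finite to anyV?)
    open FiniteType (proj₂ finK) public using () renaming (_≟_ to _≟E_; any?-finite to anyE?)

    IsIn? : ∀ v → Dec (IsIn K v)
    IsIn? v = wire? (τV K v) ×-dec ¬? (anyE? (λ e → ¬? (bang? (τV K (src K e))) ×-dec (tgt K e ≟V v)))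

    IsOut? : ∀ v → Dec (IsOut K v)
    IsOut? v = wire? (τV K v) ×-dec ¬? (anyE? (λ e → ¬? (bang? (τV K (tgt K e))) ×-dec (src K e ≟V v)))

    BoundP? : ∀ v → Dec (BoundP T K v)
    BoundP? v = map′ (BoundR⇒BoundP K v) (BoundP⇒BoundR K v)
                     (bang? (τV K v) ⊎-dec IsIn? v ⊎-dec IsOut? v)

  -- Both facts are read off from the universal property tested against
  -- the graph "P with Boolean marks on its vertices and edges".
  module PushoutFacts {A B C P : TGraph T} (f : Hom T A B) (g : Hom T A C) (p : Hom T B P) (q : Hom T C P)
      (po : IsPushout T f g p q) (finA : IsFinite T A) (finB : IsFinite T B)
      (finC : IsFinite T C) (finP : IsFinite T P) where

    -- an edge records its own mark and the marks of its endpoints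
    Marked : TGraph T
    Marked = record
      { V = V P × Bool ; E = E P × Bool × Bool × Bool
      ; src = λ (e , _ , s , _) → src P e , s ; tgt = λ (e , _ , _ , t) → tgt P e , t
      ; τV = λ (v , _) → τV P v ; τE = λ (e , _) → τE P e
      ; src-ok = λ (e , _) → src-ok P e ; tgt-ok = λ (e , _) → tgt-ok P e }

    Marked-finite : IsFinite T Marked
    Marked-finite = ×-finite (proj₁ finP) Bool-finite
                  , ×-finite (proj₂ finP) (×-finite Bool-finite (×-finite Bool-finite Bool-finite))

    mark : {X : TGraph T} (k : Hom T X P) (mv : V X → Bool) (me : E X → Bool) → Hom T X Marked
    mark {X} k mv me = record
      { vmap = λ x → vmap k x , mv x
      ; emap = λ e → emap k e , me e , mv (src X e) , mv (tgt X e)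
      ; src-pres = λ e → cong (_, mv (src X e)) (src-pres k e)
      ; tgt-pres = λ e → cong (_, mv (tgt X e)) (tgt-pres k e)
      ; τV-pres = τV-pres k ; τE-pres = τE-pres k }

    all-true : {X : Set} → X → Bool
    all-true _ = true

    marked-edge≡ : ∀ {e : E P} {a b c : Bool} → a ≡ true → b ≡ true → c ≡ true →
                   _≡_ {A = E Marked} (e , a , b , c) (e , true , true , true)
    marked-edge≡ refl refl refl = refl

    private
      module FA = FiniteGraph A finA
      module FB = FiniteGraph B finB
      module FC = FiniteGraph C finC
      module FP = FiniteGraph P finP
      commutes : p ∘ f ≈ q ∘ g
      commutes = proj₁ po

      Mediator : Hom T B Marked → Hom T C Marked → Set
      Mediator a b = Σ[ u ∈ Hom T P Marked ] ((u ∘ p ≈ a) × (u ∘ q ≈ b) ×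
                       ((u′ : Hom T P Marked) → u′ ∘ p ≈ a → u′ ∘ q ≈ b → u′ ≈ u))

      universal : (a : Hom T B Marked) (b : Hom T C Marked) → a ∘ f ≈ b ∘ g → Mediator a b
      universal = proj₂ po Marked Marked-finite

    ImageV : V P → Set
    ImageV v = (Σ[ x ∈ V B ] vmap p x ≡ v) ⊎ (Σ[ y ∈ V C ] vmap q y ≡ v)

    ImageE : E P → Set
    ImageE e = (Σ[ x ∈ E B ] emap p x ≡ e) ⊎ (Σ[ y ∈ E C ] emap q y ≡ e)

    ImageV? : ∀ v → Dec (ImageV v)
    ImageV? v = FB.anyV? (λ x → vmap p x FP.≟V v) ⊎-dec FC.anyV? (λ y → vmap q y FP.≟V v)

    ImageE? : ∀ e → Dec (ImageE e)
    ImageE? e = FB.anyE? (λ x → emap p x FP.≟E e) ⊎-dec FC.anyE? (λ y → emap q y FP.≟E e)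

    private
      by-image : Hom T P Marked
      by-image = mark (idH T) (λ v → does (ImageV? v)) (λ e → does (ImageE? e))

      everything : Hom T P Marked
      everything = mark (idH T) all-true all-true

      legs-commute : mark p all-true all-true ∘ f ≈ mark q all-true all-true ∘ g
      legs-commute = (λ z → cong (_, true) (proj₁ commutes z))
                   , (λ e → cong (λ x → x , true , true , true) (proj₂ commutes e))

      all-true-mediator : Mediator (mark p all-true all-true) (mark q all-true all-true)
      all-true-mediator = universal (mark p all-true all-true) (mark q all-true all-true) legs-commute

      mediator-unique : (u : Hom T P Marked) → u ∘ p ≈ mark p all-true all-true →
                        u ∘ q ≈ mark q all-true all-true → u ≈ proj₁ all-true-mediator
      mediator-unique = proj₂ (proj₂ (proj₂ all-true-mediator))

      by-image∘p : by-image ∘ p ≈ mark p all-true all-true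
      by-image∘p = (λ x → cong (vmap p x ,_) (dec-true (ImageV? _) (inj₁ (x , refl))))
                 , (λ e → marked-edge≡ (dec-true (ImageE? _) (inj₁ (e , refl)))
                            (dec-true (ImageV? _) (inj₁ (src B e , sym (src-pres p e))))
                            (dec-true (ImageV? _) (inj₁ (tgt B e , sym (tgt-pres p e)))))

      by-image∘q : by-image ∘ q ≈ mark q all-true all-true
      by-image∘q = (λ y → cong (vmap q y ,_) (dec-true (ImageV? _) (inj₂ (y , refl))))
                 , (λ e → marked-edge≡ (dec-true (ImageE? _) (inj₂ (e , refl)))
                            (dec-true (ImageV? _) (inj₂ (src C e , sym (src-pres q e))))
                            (dec-true (ImageV? _) (inj₂ (tgt C e , sym (tgt-pres q e)))))

      -- both are mediating morphisms, hence equal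
      by-image≈everything : by-image ≈ everything
      by-image≈everything =
        let u≈ = mediator-unique by-image by-image∘p by-image∘q
            t≈ = mediator-unique everything ((λ _ → refl) , (λ _ → refl)) ((λ _ → refl) , (λ _ → refl))
        in (λ v → trans (proj₁ u≈ v) (sym (proj₁ t≈ v)))
         , (λ e → trans (proj₂ u≈ e) (sym (proj₂ t≈ e)))

    jointly-surjective-V : ∀ v → ImageV v
    jointly-surjective-V v = does⇒witness (ImageV? v) (cong proj₂ (proj₁ by-image≈everything v))

    jointly-surjective-E : ∀ e → ImageE e
    jointly-surjective-E e =
      does⇒witness (ImageE? e) (cong (λ x → proj₁ (proj₂ x)) (proj₂ by-image≈everything e))

    private
      f-image? : ∀ x → Dec (Σ[ z ∈ V A ] vmap f z ≡ x)
      f-image? x = FA.anyV? (λ z → vmap f z FB.≟V x)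

      by-f-image : Hom T B Marked
      by-f-image = mark p (λ x → does (f-image? x)) all-true

      square : by-f-image ∘ f ≈ mark q all-true all-true ∘ g
      square = (λ z → cong₂ _,_ (proj₁ commutes z) (dec-true (f-image? _) (z , refl)))
             , (λ e → trans (cong (λ x → x , true , does (f-image? (src B (emap f e)))
                                              , does (f-image? (tgt B (emap f e))))
                                  (proj₂ commutes e))
                            (marked-edge≡ refl (dec-true (f-image? _) (src A e , sym (src-pres f e)))
                                               (dec-true (f-image? _) (tgt A e , sym (tgt-pres f e)))))

      mediator : Mediator by-f-image (mark q all-true all-true)
      mediator = universal by-f-image (mark q all-true all-true) square

    -- the mediator sends p x to a mark of x and q y to true, so p x = q y marks x
    glue : ∀ x y → vmap p x ≡ vmap q y → Σ[ z ∈ V A ] vmap f z ≡ x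
    glue x y eq = does⇒witness (f-image? x) (cong proj₂
      (trans (sym (proj₁ (proj₁ (proj₂ mediator)) x))
             (trans (cong (vmap (proj₁ mediator)) eq) (proj₁ (proj₁ (proj₂ (proj₂ mediator))) y))))

    glue-mono : Injective _≡_ _≡_ (vmap q) → ∀ x y → vmap p x ≡ vmap q y →
                Σ[ z ∈ V A ] (vmap f z ≡ x × vmap g z ≡ y)
    glue-mono q-inj x y px≡qy = z , fz≡x , q-inj (begin
        vmap q (vmap g z)   ≡⟨ sym (proj₁ commutes z) ⟩
        vmap p (vmap f z)   ≡⟨ cong (vmap p) fz≡x ⟩
        vmap p x            ≡⟨ px≡qy ⟩
        vmap q y            ∎)
      where
      z : V A
      z = proj₁ (glue x y px≡qy)
      fz≡x : vmap f z ≡ x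
      fz≡x = proj₂ (glue x y px≡qy)

  transpose : {A B C : TGraph T} (φ : Iso T A B) {a : Hom T B C} {b : Hom T A C} →
              a ∘ to φ ≈ b → b ∘ from φ ≈ a
  transpose φ {a} (≈V , ≈E) =
      (λ v → trans (sym (≈V (vmap (from φ) v))) (cong (vmap a) (proj₁ (to∘from φ) v)))
    , (λ e → trans (sym (≈E (emap (from φ) e))) (cong (emap a) (proj₂ (to∘from φ) e)))

  Iso-sym : {A B : TGraph T} → Iso T A B → Iso T B A
  Iso-sym φ = record { to = from φ ; from = to φ ; from∘to = to∘from φ ; to∘from = from∘to φ }

  rule-sym : {L I R : TGraph T} {i₁ : Hom T I L} {i₂ : Hom T I R} →
             IsRewriteRule T i₁ i₂ → IsRewriteRule T i₂ i₁
  rule-sym rule = record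
    { bangL = bangR ; bangI = bangI ; bangR = bangL ; noIsoL = noIsoR ; noIsoR = noIsoL
    ; φI = Iso-sym φI ; φO = Iso-sym φO ; φL = φR ; φR = φL
    ; i₁j₁ = i₂j₂ ; i₂j₂ = i₁j₁ ; i₁k₁ = i₂k₂ ; i₂k₂ = i₁k₁
    ; j₂φI = transpose φI {j₂} {j₁} j₂φI ; k₂φO = transpose φO {k₂} {k₁} k₂φO }
    where open IsRewriteRule rule

  module RuleFacts {L I R : TGraph T} {i₁ : Hom T I L} {i₂ : Hom T I R}
                   (rule : IsRewriteRule T i₁ i₂) (mono₂ : Mono T i₂) where
    open IsRewriteRule rule

    -- i₁ ∘ φL is the inclusion Bound!(L) ↪ L, since i₁ ∘ j₁ and i₁ ∘ k₁ are
    private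
      i₁∘φL : (b : V (Bound! T L)) → BoundP T L (value b) → vmap i₁ (vmap (to φL) b) ≡ value b
      i₁∘φL (x , _) (inj₁ b) = proj₁ i₁j₁ (x , [ inj₁ b ])
      i₁∘φL (x , _) (inj₂ (nb , inj₁ i)) = proj₁ i₁j₁ (x , [ inj₂ (nb , i) ])
      i₁∘φL (x , _) (inj₂ (nb , inj₂ o)) = proj₁ i₁k₁ (x , [ inj₂ (nb , o) ])

    boundary-in-interface : ∀ x → BoundR L x → Σ[ z ∈ V I ] vmap i₁ z ≡ x
    boundary-in-interface x bx =
      let bp = BoundR⇒BoundP L x bx in vmap (to φL) (x , [ bp ]) , i₁∘φL (x , [ bp ]) bp

    bang-edge-in-interface : ∀ e → IsBang T L (src L e) → BoundR L (tgt L e) →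
                             Σ[ e′ ∈ E I ] emap i₁ e′ ≡ e
    bang-edge-in-interface e bs (inj₁ bt) = _ , proj₂ i₁j₁ (e , [ inj₁ bs , inj₁ bt ])
    bang-edge-in-interface e bs (inj₂ (inj₁ it)) =
      _ , proj₂ i₁j₁ (e , [ inj₁ bs , InR⇒InP L _ (inj₂ it) ])
    bang-edge-in-interface e bs (inj₂ (inj₂ ot)) =
      _ , proj₂ i₁k₁ (e , [ inj₁ bs , OutR⇒OutP L _ (inj₂ ot) ])

    interface-is-boundary : ∀ z → Irrelevant (BoundP T L (vmap i₁ z))
    interface-is-boundary z = via (vmap (from φL) z) (proj₁ (to∘from φL) z)
      where
      via : (b : V (Bound! T L)) → vmap (to φL) b ≡ z → Irrelevant (BoundP T L (vmap i₁ z))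
      via (x , [ bp ]) eq = [ subst (BoundP T L) (trans (sym (i₁∘φL (x , [ bp ]) bp)) (cong (vmap i₁) eq)) bp ]

    wire-R⇒L : ∀ z → Wire R (vmap i₂ z) → Wire L (vmap i₁ z)
    wire-R⇒L z w = type-to i₁ (isWireT T) z (type-from i₂ (isWireT T) z w)

    -- φO (resp. φI) matches an output (input) i₂ z of R with i₁ z in L,
    -- because it commutes with k₁, k₂ (resp. j₁, j₂)
    output-match : ∀ z (o : V (Out! T R)) → value o ≡ vmap i₂ z → value (vmap (from φO) o) ≡ vmap i₁ z
    output-match z o eq = begin
      value o′               ≡⟨ sym (proj₁ i₁k₁ o′) ⟩
      vmap i₁ (vmap k₁ o′)   ≡⟨ cong (vmap i₁) k₁o′≡z ⟩
      vmap i₁ z              ∎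
      where
      o′ : V (Out! T L)
      o′ = vmap (from φO) o
      k₁o′≡z : vmap k₁ o′ ≡ z
      k₁o′≡z = begin
        vmap k₁ o′                   ≡⟨ sym (proj₁ k₂φO o′) ⟩
        vmap k₂ (vmap (to φO) o′)    ≡⟨ cong (vmap k₂) (proj₁ (to∘from φO) o) ⟩
        vmap k₂ o                    ≡⟨ proj₁ mono₂ (trans (proj₁ i₂k₂ o) eq) ⟩
        z                            ∎

    input-match : ∀ z (i : V (In! T R)) → value i ≡ vmap i₂ z → value (vmap (from φI) i) ≡ vmap i₁ z
    input-match z i eq = begin
      value i′               ≡⟨ sym (proj₁ i₁j₁ i′) ⟩
      vmap i₁ (vmap j₁ i′)   ≡⟨ cong (vmap i₁) j₁i′≡z ⟩
      vmap i₁ z              ∎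
      where
      i′ : V (In! T L)
      i′ = vmap (from φI) i
      j₁i′≡z : vmap j₁ i′ ≡ z
      j₁i′≡z = begin
        vmap j₁ i′                   ≡⟨ sym (proj₁ j₂φI i′) ⟩
        vmap j₂ (vmap (to φI) i′)    ≡⟨ cong (vmap j₂) (proj₁ (to∘from φI) i) ⟩
        vmap j₂ i                    ≡⟨ proj₁ mono₂ (trans (proj₁ i₂j₂ i) eq) ⟩
        z                            ∎

    IsOut-R⇒L : ∀ z → IsOut R (vmap i₂ z) → IsOut L (vmap i₁ z)
    IsOut-R⇒L z out = output (vmap (from φO) o) (output-match z o refl) (wire-R⇒L z (proj₁ out))
      where
      o : V (Out! T R)
      o = vmap i₂ z , [ OutR⇒OutP R _ (inj₂ out) ]
      output : ∀ {x} (w : V (Out! T L)) → value w ≡ x → Wire L x → IsOut L x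
      output (v , [ op ]) refl w = wire-output L v w op

    IsIn-R⇒L : ∀ z → IsIn R (vmap i₂ z) → IsIn L (vmap i₁ z)
    IsIn-R⇒L z inp = input (vmap (from φI) i) (input-match z i refl) (wire-R⇒L z (proj₁ inp))
      where
      i : V (In! T R)
      i = vmap i₂ z , [ InR⇒InP R _ (inj₂ inp) ]
      input : ∀ {x} (w : V (In! T L)) → value w ≡ x → Wire L x → IsIn L x
      input (v , [ ip ]) refl w = wire-input L v w ip

  record Selection (X : TGraph T) : Set₁ where
    field
      Pv : V X → Set
      Pe : E X → Set
      Pe⇒Pv-src : ∀ e → Pe e → Pv (src X e)
      Pe⇒Pv-tgt : ∀ e → Pe e → Pv (tgt X e)

  open Selection public

  Selected : (X : TGraph T) → Selection X → TGraph T
  Selected X S = record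
    { V = Refinement (V X) (Pv S)
    ; E = Refinement (E X) (Pe S)
    ; src = λ e → src X (value e) , Data.Irrelevant.map (Pe⇒Pv-src S (value e)) (proof e)
    ; tgt = λ e → tgt X (value e) , Data.Irrelevant.map (Pe⇒Pv-tgt S (value e)) (proof e)
    ; τV = λ v → τV X (value v)
    ; τE = λ e → τE X (value e)
    ; src-ok = λ e → src-ok X (value e)
    ; tgt-ok = λ e → tgt-ok X (value e) }

  module SelectionMap {D X Y : TGraph T} (k : Hom T D X) (k′ : Hom T D Y) (mono-k : Mono T k)
      (S : Selection X) (S′ : Selection Y)
      (agree-v : ∀ y → Pv S (vmap k y) → Pv S′ (vmap k′ y))
      (agree-e : ∀ e → Pe S (emap k e) → Pe S′ (emap k′ e))
      (pre-v : ∀ v → .(Pv S v) → Σ[ y ∈ V D ] vmap k y ≡ v)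
      (pre-e : ∀ e → .(Pe S e) → Σ[ e′ ∈ E D ] emap k e′ ≡ e) where

    map-v : V (Selected X S) → V (Selected Y S′)
    map-v (v , [ p ]) = let y , ky≡v = pre-v v p in
      vmap k′ y , [ agree-v y (subst (Pv S) (sym ky≡v) p) ]

    map-e : E (Selected X S) → E (Selected Y S′)
    map-e (e , [ p ]) = let e′ , ke′≡e = pre-e e p in
      emap k′ e′ , [ agree-e e′ (subst (Pe S) (sym ke′≡e) p) ]

    -- map-v is k′ ∘ k⁻¹ (any k-preimage will do, k being mono)
    map-v-value : ∀ v y → vmap k y ≡ value v → value (map-v v) ≡ vmap k′ y
    map-v-value (v , [ p ]) y ky≡v = cong (vmap k′) (proj₁ mono-k (trans (proj₂ (pre-v v p)) (sym ky≡v)))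

    map-e-value : ∀ e e′ → emap k e′ ≡ value e → value (map-e e) ≡ emap k′ e′
    map-e-value (e , [ p ]) e′ ke′≡e = cong (emap k′) (proj₂ mono-k (trans (proj₂ (pre-e e p)) (sym ke′≡e)))

    factor-v : (f : Hom T Y X) → (∀ y → vmap f (vmap k′ y) ≡ vmap k y) →
               ∀ v → vmap f (value (map-v v)) ≡ value v
    factor-v f fk′≡k (v , [ p ]) = trans (fk′≡k _) (proj₂ (pre-v v p))

    factor-e : (f : Hom T Y X) → (∀ e → emap f (emap k′ e) ≡ emap k e) →
               ∀ e → emap f (value (map-e e)) ≡ value e
    factor-e f fk′≡k (e , [ p ]) = trans (fk′≡k _) (proj₂ (pre-e e p))

    hom : Hom T (Selected X S) (Selected Y S′)
    hom = record
      { vmap = map-v ; emap = map-e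
      ; src-pres = λ { (e , [ p ]) → let e′ , ke′≡e = pre-e e p in value-injective (sym
          (trans (map-v-value (src X e , [ Pe⇒Pv-src S e p ]) (src D e′)
                   (trans (sym (src-pres k e′)) (cong (src X) ke′≡e)))
                 (sym (src-pres k′ e′)))) }
      ; tgt-pres = λ { (e , [ p ]) → let e′ , ke′≡e = pre-e e p in value-injective (sym
          (trans (map-v-value (tgt X e , [ Pe⇒Pv-tgt S e p ]) (tgt D e′)
                   (trans (sym (tgt-pres k e′)) (cong (tgt X) ke′≡e)))
                 (sym (tgt-pres k′ e′)))) }
      ; τV-pres = λ { (v , [ p ]) → let y , ky≡v = pre-v v p in
          trans (τV-pres k′ y) (trans (sym (τV-pres k y)) (cong (τV X) ky≡v)) }
      ; τE-pres = λ { (e , [ p ]) → let e′ , ke′≡e = pre-e e p in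
          trans (τE-pres k′ e′) (trans (sym (τE-pres k e′)) (cong (τE X) ke′≡e)) } }

  module SelectionIso {D X Y : TGraph T} (k : Hom T D X) (k′ : Hom T D Y)
      (mono-k : Mono T k) (mono-k′ : Mono T k′) (S : Selection X) (S′ : Selection Y)
      (agree-v : ∀ y → Pv S (vmap k y) → Pv S′ (vmap k′ y))
      (agree-e : ∀ e → Pe S (emap k e) → Pe S′ (emap k′ e))
      (agree-v′ : ∀ y → Pv S′ (vmap k′ y) → Pv S (vmap k y))
      (agree-e′ : ∀ e → Pe S′ (emap k′ e) → Pe S (emap k e))
      (pre-v : ∀ v → .(Pv S v) → Σ[ y ∈ V D ] vmap k y ≡ v)
      (pre-e : ∀ e → .(Pe S e) → Σ[ e′ ∈ E D ] emap k e′ ≡ e)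
      (pre-v′ : ∀ v → .(Pv S′ v) → Σ[ y ∈ V D ] vmap k′ y ≡ v)
      (pre-e′ : ∀ e → .(Pe S′ e) → Σ[ e′ ∈ E D ] emap k′ e′ ≡ e) where

    module Fwd = SelectionMap k k′ mono-k S S′ agree-v agree-e pre-v pre-e
    module Bwd = SelectionMap k′ k mono-k′ S′ S agree-v′ agree-e′ pre-v′ pre-e′

    -- both composites fix the underlying vertex (edge) of X, resp. Y
    iso : Iso T (Selected X S) (Selected Y S′)
    iso = record
      { to = Fwd.hom ; from = Bwd.hom
      ; from∘to =
          (λ { (v , [ p ]) → let y , ky≡v = pre-v v p in value-injective (trans
                 (Bwd.map-v-value (Fwd.map-v (v , [ p ])) y
                    (sym (Fwd.map-v-value (v , [ p ]) y ky≡v))) ky≡v) })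
        , (λ { (e , [ p ]) → let e′ , ke′≡e = pre-e e p in value-injective (trans
                 (Bwd.map-e-value (Fwd.map-e (e , [ p ])) e′
                    (sym (Fwd.map-e-value (e , [ p ]) e′ ke′≡e))) ke′≡e) })
      ; to∘from =
          (λ { (v , [ p ]) → let y , k′y≡v = pre-v′ v p in value-injective (trans
                 (Fwd.map-v-value (Bwd.map-v (v , [ p ])) y
                    (sym (Bwd.map-v-value (v , [ p ]) y k′y≡v))) k′y≡v) })
        , (λ { (e , [ p ]) → let e′ , k′e′≡e = pre-e′ e p in value-injective (trans
                 (Fwd.map-e-value (Bwd.map-e (e , [ p ])) e′
                    (sym (Bwd.map-e-value (e , [ p ]) e′ k′e′≡e))) k′e′≡e) }) }

  InSel : (K : TGraph T) → Selection K
  InSel K = record { Pv = InP T K ; Pe = λ e → InP T K (src K e) × InP T K (tgt K e)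
                   ; Pe⇒Pv-src = λ _ → proj₁ ; Pe⇒Pv-tgt = λ _ → proj₂ }

  OutSel : (K : TGraph T) → Selection K
  OutSel K = record { Pv = OutP T K ; Pe = λ e → OutP T K (src K e) × OutP T K (tgt K e)
                    ; Pe⇒Pv-src = λ _ → proj₁ ; Pe⇒Pv-tgt = λ _ → proj₂ }

  BangEdgeSel : (K : TGraph T) → (V K → Set) → Selection K
  BangEdgeSel K P = record { Pv = P ; Pe = λ e → IsBang T K (src K e) × P (src K e) × P (tgt K e)
                           ; Pe⇒Pv-src = λ _ p → proj₁ (proj₂ p) ; Pe⇒Pv-tgt = λ _ p → proj₂ (proj₂ p) }

  BoundSel : (K : TGraph T) → Selection K
  BoundSel K = BangEdgeSel K (BoundP T K)

  module _ {D X Y : TGraph T} (k : Hom T D X) (k′ : Hom T D Y) {P : V X → Set} {P′ : V Y → Set}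
           (convert : ∀ y → P (vmap k y) → P′ (vmap k′ y)) where
    convert-src : ∀ e → P (src X (emap k e)) → P′ (src Y (emap k′ e))
    convert-src e p = subst P′ (sym (src-pres k′ e)) (convert _ (subst P (src-pres k e) p))

    convert-tgt : ∀ e → P (tgt X (emap k e)) → P′ (tgt Y (emap k′ e))
    convert-tgt e p = subst P′ (sym (tgt-pres k′ e)) (convert _ (subst P (tgt-pres k e) p))

    both-ends-agree : ∀ e → P (src X (emap k e)) × P (tgt X (emap k e)) →
                      P′ (src Y (emap k′ e)) × P′ (tgt Y (emap k′ e))
    both-ends-agree e (ps , pt) = convert-src e ps , convert-tgt e pt

    bang-edge-agree : ∀ e → Pe (BangEdgeSel X P) (emap k e) → Pe (BangEdgeSel Y P′) (emap k′ e)
    bang-edge-agree e (bs , ps , pt) =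
        subst (IsBang T Y) (sym (src-pres k′ e))
          (type-to k′ (isBangT T) _ (type-from k (isBangT T) _ (subst (IsBang T X) (src-pres k e) bs)))
      , both-ends-agree e (ps , pt)

  -- A graph with no edges and neither !-vertices nor node-vertices is a
  -- string graph: every condition is about edges or node-vertices.
  trivial-string-graph : (K : TGraph T) → (∀ v → ¬ isBangT T (τV K v)) →
                         (∀ v → ¬ isNodeT T (τV K v)) → ¬ E K → IsStringGraph T K
  trivial-string-graph K noBang noNode noEdge = record
    { noBang = noBang
    ; node-inj = λ n isNode → ⊥-elim (noNode n isNode)
    ; node-surj = λ n isNode → ⊥-elim (noNode n isNode)
    ; wire-in = λ _ _ e → ⊥-elim (noEdge e)
    ; wire-out = λ _ _ e → ⊥-elim (noEdge e) }

  module _ (K : TGraph T) (P : V K → Set) where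
    EdgeRel-full⇒ : ∀ {x y} → EdgeRel T (fullSub T K P) x y → EdgeRel T K (value x) (value y)
    EdgeRel-full⇒ (e , s≡ , t≡) = value e , cong value s≡ , cong value t≡

    EdgeRel-⇒full : ∀ x y → EdgeRel T K (value x) (value y) → EdgeRel T (fullSub T K P) x y
    EdgeRel-⇒full (x , [ px ]) (y , [ py ]) (e , s≡ , t≡) =
      (e , [ subst P (sym s≡) px , subst P (sym t≡) py ]) , value-injective s≡ , value-injective t≡

  EdgeRel-along : {A B : TGraph T} (f : Hom T A B) → ∀ {x y} →
                  EdgeRel T A x y → EdgeRel T B (vmap f x) (vmap f y)
  EdgeRel-along f (e , s≡ , t≡) =
    emap f e , trans (src-pres f e) (cong (vmap f) s≡) , trans (tgt-pres f e) (cong (vmap f) t≡)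

  Nested : TGraph T → Set
  Nested K = ∀ b b′ → IsBang T K b → IsBang T K b′ → Succ T K b b′ → ∀ v → Succ T K b′ v → Succ T K b v

  module ReflectBang {A B : TGraph T} (f : Hom T A B) (mono-f : Mono T f)
      (lift : ∀ x y → IsBang T A x → EdgeRel T B (vmap f x) (vmap f y) → EdgeRel T A x y) where

    fβ : V (β T A) → V (β T B)
    fβ (x , [ bx ]) = vmap f x , [ type-to f (isBangT T) x bx ]

    push : ∀ {x y} → EdgeRel T (β T A) x y → EdgeRel T (β T B) (fβ x) (fβ y)
    push {x} {y} rel = EdgeRel-⇒full B (IsBang T B) (fβ x) (fβ y)
                         (EdgeRel-along f (EdgeRel-full⇒ A (IsBang T A) rel))

    pull : ∀ x y → EdgeRel T (β T B) (fβ x) (fβ y) → EdgeRel T (β T A) x y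
    pull (x , [ bx ]) y rel = EdgeRel-⇒full A (IsBang T A) (x , [ bx ]) y
      (lift x (value y) (recompute (bang? (τV A x)) bx) (EdgeRel-full⇒ B (IsBang T B) rel))

    posetal-reflect : IsPosetal T (β T B) → IsPosetal T (β T A)
    posetal-reflect (uniqueB , orderB) = unique , record
      { isPreorder = record
        { isEquivalence = isEquivalence
        ; reflexive = λ {x} {y} x≡y → pull x y (IsPartialOrder.reflexive orderB (cong fβ x≡y))
        ; trans = λ {x} {_} {z} r s → pull x z (IsPartialOrder.trans orderB (push r) (push s)) }
      ; antisym = λ r s →
          value-injective (proj₁ mono-f (cong value (IsPartialOrder.antisym orderB (push r) (push s)))) }
      where
      -- two parallel edges of β(A) have parallel images, hence equal images
      unique : ∀ e e′ → src (β T A) e ≡ src (β T A) e′ → tgt (β T A) e ≡ tgt (β T A) e′ → e ≡ e′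
      unique e e′ s≡ t≡ =
        let (pe , ps , pt) = push (e , refl , refl)
            (pe′ , ps′ , pt′) = push (e′ , refl , refl)
        in value-injective (proj₂ mono-f (cong value
             (uniqueB pe pe′ (trans ps (trans (cong fβ s≡) (sym ps′)))
                             (trans pt (trans (cong fβ t≡) (sym pt′))))))

    nested-reflect : Nested B → Nested A
    nested-reflect nestedB b b′ bb bb′ b→b′ v b′→v = lift b v bb
      (nestedB _ _ (type-to f (isBangT T) b bb) (type-to f (isBangT T) b′ bb′)
               (EdgeRel-along f b→b′) _ (EdgeRel-along f b′→v))

  -- One direction of the double-pushout argument, from the left square
  -- (I, L, D, G) to the right square (I, R, D, H).  The other direction is
  -- the same module applied to the mirrored diagram.
  module Side {L I R G D H : TGraph T}
      (i₁ : Hom T I L) (i₂ : Hom T I R) (m : Hom T L G) (d : Hom T I D)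
      (r : Hom T R H) (g : Hom T D G) (h : Hom T D H)
      (bangG : IsBangGraph T G) (bangD : IsBangGraph T D) (bangH : IsBangGraph T H)
      (mono-i₁ : Mono T i₁) (mono-i₂ : Mono T i₂) (mono-g : Mono T g) (mono-h : Mono T h)
      (po₁ : IsPushout T i₁ d m g) (po₂ : IsPushout T i₂ d r h)
      (rule : IsRewriteRule T i₁ i₂) where

    open IsRewriteRule rule using (bangL; bangI; bangR; noIsoL; noIsoR)
    open IsBangGraph using (finite)
    private
      module P₁ = PushoutFacts i₁ d m g po₁ (finite bangI) (finite bangL) (finite bangD) (finite bangG)
      module P₂ = PushoutFacts i₂ d r h po₂ (finite bangI) (finite bangR) (finite bangD) (finite bangH)
      module Lhs = RuleFacts rule mono-i₂
      module Rhs = RuleFacts (rule-sym rule) mono-i₁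
      module FD = FiniteGraph D (finite bangD)
      module FG = FiniteGraph G (finite bangG)
      square₁ : m ∘ i₁ ≈ g ∘ d
      square₁ = proj₁ po₁
      square₂ : r ∘ i₂ ≈ h ∘ d
      square₂ = proj₁ po₂

    m∘i₁ : ∀ z y → vmap d z ≡ y → vmap m (vmap i₁ z) ≡ vmap g y
    m∘i₁ z y dz≡y = trans (proj₁ square₁ z) (cong (vmap g) dz≡y)

    wire-G⇒H : ∀ y → Wire G (vmap g y) → Wire H (vmap h y)
    wire-G⇒H y w = type-to h (isWireT T) y (type-from g (isWireT T) y w)

    wire-interface : ∀ z y → vmap d z ≡ y → Wire G (vmap g y) → Wire R (vmap i₂ z)
    wire-interface z y dz≡y w = type-to i₂ (isWireT T) z (type-from d (isWireT T) z
                                  (subst (Wire D) (sym dz≡y) (type-from g (isWireT T) y w)))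

    -- An edge into h y
    -- either comes from D, and then enters g y, or from R; in the latter case
    -- it enters an interface wire of R, which must be an output of R, so the
    -- corresponding vertex of L is an output, fed (no isolated wires) by an
    -- edge whose image under m enters g y.

    IsIn-transfer : ∀ y → IsIn G (vmap g y) → IsIn H (vmap h y)
    IsIn-transfer y (wG , noInG) = wire-G⇒H y wG , no-incoming
      where
      no-incoming : ¬ Incoming H (vmap h y)
      no-incoming inc with P₂.jointly-surjective-E (proj₁ inc)
      ... | inj₂ (e , he≡) =
        let nbs , h-tgt≡ = Incoming-pullback h inc e he≡
        in noInG (Incoming-along g y (e , nbs , proj₁ mono-h h-tgt≡))
      ... | inj₁ (e₁ , re₁≡) =
        let nbs , r-tgt≡ = Incoming-pullback r inc e₁ re₁≡
            z , i₂z≡x , dz≡y = P₂.glue-mono (proj₁ mono-h) (tgt R e₁) y r-tgt≡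
            out-R : IsOut R (vmap i₂ z)
            out-R = incoming-boundary-wire⇒IsOut R _ (wire-interface z y dz≡y wG)
                      (Rhs.interface-is-boundary z) (e₁ , nbs , sym i₂z≡x)
        in noInG (subst (Incoming G) (m∘i₁ z y dz≡y)
                   (Incoming-along m _ (IsOut⇒Incoming L noIsoL _ (Lhs.IsOut-R⇒L z out-R))))

    IsOut-transfer : ∀ y → IsOut G (vmap g y) → IsOut H (vmap h y)
    IsOut-transfer y (wG , noOutG) = wire-G⇒H y wG , no-outgoing
      where
      no-outgoing : ¬ Outgoing H (vmap h y)
      no-outgoing out with P₂.jointly-surjective-E (proj₁ out)
      ... | inj₂ (e , he≡) =
        let nbt , h-src≡ = Outgoing-pullback h out e he≡
        in noOutG (Outgoing-along g y (e , nbt , proj₁ mono-h h-src≡))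
      ... | inj₁ (e₁ , re₁≡) =
        let nbt , r-src≡ = Outgoing-pullback r out e₁ re₁≡
            z , i₂z≡x , dz≡y = P₂.glue-mono (proj₁ mono-h) (src R e₁) y r-src≡
            in-R : IsIn R (vmap i₂ z)
            in-R = outgoing-boundary-wire⇒IsIn R _ (wire-interface z y dz≡y wG)
                     (Rhs.interface-is-boundary z) (e₁ , nbt , sym i₂z≡x)
        in noOutG (subst (Outgoing G) (m∘i₁ z y dz≡y)
                    (Outgoing-along m _ (IsIn⇒Outgoing L noIsoL _ (Lhs.IsIn-R⇒L z in-R))))

    bang-G⇒H : ∀ y → IsBang T G (vmap g y) → IsBang T H (vmap h y)
    bang-G⇒H y b = type-to h (isBangT T) y (type-from g (isBangT T) y b)

    InP-transfer : ∀ y → InP T G (vmap g y) → InP T H (vmap h y)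
    InP-transfer y p with InP⇒InR G _ p
    ... | inj₁ b = inj₁ (bang-G⇒H y b)
    ... | inj₂ i = InR⇒InP H _ (inj₂ (IsIn-transfer y i))

    OutP-transfer : ∀ y → OutP T G (vmap g y) → OutP T H (vmap h y)
    OutP-transfer y p with OutP⇒OutR G _ p
    ... | inj₁ b = inj₁ (bang-G⇒H y b)
    ... | inj₂ o = OutR⇒OutP H _ (inj₂ (IsOut-transfer y o))

    BoundP-transfer : ∀ y → BoundP T G (vmap g y) → BoundP T H (vmap h y)
    BoundP-transfer y p with BoundP⇒BoundR G _ p
    ... | inj₁ b = inj₁ (bang-G⇒H y b)
    ... | inj₂ (inj₁ i) = BoundR⇒BoundP H _ (inj₂ (inj₁ (IsIn-transfer y i)))
    ... | inj₂ (inj₂ o) = BoundR⇒BoundP H _ (inj₂ (inj₂ (IsOut-transfer y o)))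

    -- Boundary vertices of G lie in the image of g: one coming from L is on
    -- the boundary of L (boundaries reflect along m), hence in the interface.
    boundary-preimage : ∀ v → BoundR G v → Σ[ y ∈ V D ] vmap g y ≡ v
    boundary-preimage v bv with P₁.jointly-surjective-V v
    ... | inj₂ pre = pre
    ... | inj₁ (x , mx≡v) with Lhs.boundary-in-interface x (BoundR-reflect m x (subst (BoundR G) (sym mx≡v) bv))
    ...   | z , i₁z≡x = vmap d z , (begin
        vmap g (vmap d z)    ≡⟨ sym (proj₁ square₁ z) ⟩
        vmap m (vmap i₁ z)   ≡⟨ cong (vmap m) i₁z≡x ⟩
        vmap m x             ≡⟨ mx≡v ⟩
        v                    ∎)

    bang-edge-preimage : ∀ e → IsBang T G (src G e) → BoundR G (tgt G e) → Σ[ e′ ∈ E D ] emap g e′ ≡ e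
    bang-edge-preimage e bs bt with P₁.jointly-surjective-E e
    ... | inj₂ pre = pre
    ... | inj₁ (e₁ , me₁≡e)
      with Lhs.bang-edge-in-interface e₁
             (type-from m (isBangT T) _
               (subst (IsBang T G) (trans (cong (src G) (sym me₁≡e)) (src-pres m e₁)) bs))
             (BoundR-reflect m _ (subst (BoundR G) (trans (cong (tgt G) (sym me₁≡e)) (tgt-pres m e₁)) bt))
    ...   | e′ , i₁e′≡e₁ = emap d e′ , (begin
        emap g (emap d e′)    ≡⟨ sym (proj₂ square₁ e′) ⟩
        emap m (emap i₁ e′)   ≡⟨ cong (emap m) i₁e′≡e₁ ⟩
        emap m e₁             ≡⟨ me₁≡e ⟩
        e                     ∎)

    -- Versions for irrelevant hypotheses, obtained by deciding the conclusion.
    boundary-preimage-irr : ∀ v → .(BoundP T G v) → Σ[ y ∈ V D ] vmap g y ≡ v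
    boundary-preimage-irr v bp =
      recompute (FD.anyV? (λ y → vmap g y FG.≟V v)) (boundary-preimage v (BoundP⇒BoundR G v bp))

    bang-edge-preimage-irr : ∀ e → .(IsBang T G (src G e)) → .(BoundP T G (tgt G e)) →
                             Σ[ e′ ∈ E D ] emap g e′ ≡ e
    bang-edge-preimage-irr e bs bt = recompute (FD.anyE? (λ e′ → emap g e′ FG.≟E e))
      (bang-edge-preimage e (recompute (bang? _) bs) (BoundP⇒BoundR G _ bt))

    -- A wire of H comes from R, which has none, or from D.  In the latter case
    -- its image in G has an edge; if that edge comes from D it is carried to H
    -- by h, and if it comes from L its endpoint lies in the interface, so the
    -- wire comes from R after all.
    touching-from-R : ∀ x → Wire R x → Touching H (vmap r x)
    touching-from-R x w =
      Touching-along r x (U-incident⇒Touching R x _ (noIsoR (x , [ wire⇒notBang R x w ]) w))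

    touching-over-D : NoIsolated T (U T G) → ∀ y → Wire D y → Touching H (vmap h y)
    touching-over-D noIsoG y wy =
      from-G (U-incident⇒Touching G (vmap g y) _ (noIsoG (vmap g y , [ wire⇒notBang G _ wG ])))
      where
      wG : Wire G (vmap g y)
      wG = type-to g (isWireT T) y wy
      from-G : Touching G (vmap g y) → Touching H (vmap h y)
      from-G t with P₁.jointly-surjective-E (proj₁ t)
      ... | inj₂ (e , ge≡) = Touching-along h y (Touching-pullback g mono-g t e ge≡)
      ... | inj₁ (e₁ , me₁≡) =
        let x , mx≡gy = Touching-endpoint m t e₁ me₁≡
            z , _ , dz≡y = P₁.glue-mono (proj₁ mono-g) x y mx≡gy
            wR : Wire R (vmap i₂ z)
            wR = type-to i₂ (isWireT T) z (type-from d (isWireT T) z (subst (Wire D) (sym dz≡y) wy))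
        in subst (Touching H) (trans (proj₁ square₂ z) (cong (vmap h) dz≡y)) (touching-from-R (vmap i₂ z) wR)

    no-isolated-H : NoIsolated T (U T G) → NoIsolatedWire T (U T H)
    no-isolated-H noIsoG (v , [ nb ]) w = Touching⇒U-incident H v nb (touching v w)
      where
      touching : ∀ v → Wire H v → Touching H v
      touching v w with P₂.jointly-surjective-V v
      ... | inj₁ (x , rx≡v) =
        subst (Touching H) rx≡v (touching-from-R x (type-from r (isWireT T) x (subst (Wire H) (sym rx≡v) w)))
      ... | inj₂ (y , hy≡v) =
        subst (Touching H) hy≡v (touching-over-D noIsoG y (type-from h (isWireT T) y (subst (Wire H) (sym hy≡v) w)))

    private
      In-from-bang : ∀ e → Pe (InSel G) e → IsBang T G (src G e)
      In-from-bang e (ps , pt) = In-edge-from-bang G e (InP⇒InR G _ ps) (InP⇒InR G _ pt)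

      Out-from-bang : ∀ e → Pe (OutSel G) e → IsBang T G (src G e)
      Out-from-bang e (ps , pt) = Out-edge-from-bang G e (OutP⇒OutR G _ ps) (OutP⇒OutR G _ pt)

    module _ (S : Selection G) (v-bound : ∀ v → Pv S v → BoundP T G v)
             (e-bang : ∀ e → Pe S e → IsBang T G (src G e)) where
      selection-pre-v : ∀ v → .(Pv S v) → Σ[ y ∈ V D ] vmap g y ≡ v
      selection-pre-v v p = boundary-preimage-irr v (v-bound v p)

      selection-pre-e : ∀ e → .(Pe S e) → Σ[ e′ ∈ E D ] emap g e′ ≡ e
      selection-pre-e e p = bang-edge-preimage-irr e (e-bang e p) (v-bound _ (Pe⇒Pv-tgt S e p))

    In-covered-v : ∀ v → .(InP T G v) → Σ[ y ∈ V D ] vmap g y ≡ v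
    In-covered-v = selection-pre-v (InSel G) (InP⇒BoundP G) In-from-bang
    In-covered-e : ∀ e → .(Pe (InSel G) e) → Σ[ e′ ∈ E D ] emap g e′ ≡ e
    In-covered-e = selection-pre-e (InSel G) (InP⇒BoundP G) In-from-bang
    Out-covered-v : ∀ v → .(OutP T G v) → Σ[ y ∈ V D ] vmap g y ≡ v
    Out-covered-v = selection-pre-v (OutSel G) (OutP⇒BoundP G) Out-from-bang
    Out-covered-e : ∀ e → .(Pe (OutSel G) e) → Σ[ e′ ∈ E D ] emap g e′ ≡ e
    Out-covered-e = selection-pre-e (OutSel G) (OutP⇒BoundP G) Out-from-bang
    Bound-covered-v : ∀ v → .(BoundP T G v) → Σ[ y ∈ V D ] vmap g y ≡ v
    Bound-covered-v = selection-pre-v (BoundSel G) (λ _ p → p) (λ _ → proj₁)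
    Bound-covered-e : ∀ e → .(Pe (BoundSel G) e) → Σ[ e′ ∈ E D ] emap g e′ ≡ e
    Bound-covered-e = selection-pre-e (BoundSel G) (λ _ p → p) (λ _ → proj₁)

  module DoublePushout {L I R G D H : TGraph T}
      (i₁ : Hom T I L) (i₂ : Hom T I R) (m : Hom T L G) (d : Hom T I D)
      (r : Hom T R H) (g : Hom T D G) (h : Hom T D H)
      (bangG : IsBangGraph T G) (bangD : IsBangGraph T D) (bangH : IsBangGraph T H)
      (mono-i₁ : Mono T i₁) (mono-i₂ : Mono T i₂) (mono-g : Mono T g) (mono-h : Mono T h)
      (po₁ : IsPushout T i₁ d m g) (po₂ : IsPushout T i₂ d r h)
      (rule : IsRewriteRule T i₁ i₂) (noIsoG : NoIsolated T (U T G)) where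

    module GH = Side i₁ i₂ m d r g h bangG bangD bangH mono-i₁ mono-i₂ mono-g mono-h po₁ po₂ rule
    module HG = Side i₂ i₁ r d m h g bangH bangD bangG mono-i₂ mono-i₁ mono-h mono-g po₂ po₁ (rule-sym rule)

    PJ : V D → Set
    PJ y = BoundP T G (vmap g y)

    JSel : Selection D
    JSel = BangEdgeSel D PJ

    J : TGraph T
    J = Selected D JSel

    ι : Hom T J D
    ι = record { vmap = value ; emap = value ; src-pres = λ _ → refl ; tgt-pres = λ _ → refl
               ; τV-pres = λ _ → refl ; τE-pres = λ _ → refl }

    ι-mono : Mono T ι
    ι-mono = value-injective , value-injective

    id-mono : Mono T (idH T {D})
    id-mono = (λ eq → eq) , (λ eq → eq)

    module ΦL = SelectionIso g (idH T) mono-g id-mono (BoundSel G) JSel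
      (λ _ p → p) (bang-edge-agree g (idH T) {BoundP T G} {PJ} (λ _ p → p))
      (λ _ p → p) (bang-edge-agree (idH T) g {PJ} {BoundP T G} (λ _ p → p))
      GH.Bound-covered-v GH.Bound-covered-e
      (λ y _ → y , refl) (λ e _ → e , refl)

    module ΦR = SelectionIso h (idH T) mono-h id-mono (BoundSel H) JSel
      HG.BoundP-transfer (bang-edge-agree h (idH T) {BoundP T H} {PJ} HG.BoundP-transfer)
      GH.BoundP-transfer (bang-edge-agree (idH T) h {PJ} {BoundP T H} GH.BoundP-transfer)
      HG.Bound-covered-v HG.Bound-covered-e (λ y _ → y , refl) (λ e _ → e , refl)

    module ΦI = SelectionIso g h mono-g mono-h (InSel G) (InSel H)
      GH.InP-transfer (both-ends-agree g h {InP T G} {InP T H} GH.InP-transfer)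
      HG.InP-transfer (both-ends-agree h g {InP T H} {InP T G} HG.InP-transfer)
      GH.In-covered-v GH.In-covered-e HG.In-covered-v HG.In-covered-e

    module ΦO = SelectionIso g h mono-g mono-h (OutSel G) (OutSel H)
      GH.OutP-transfer (both-ends-agree g h {OutP T G} {OutP T H} GH.OutP-transfer)
      HG.OutP-transfer (both-ends-agree h g {OutP T H} {OutP T G} HG.OutP-transfer)
      GH.Out-covered-v GH.Out-covered-e HG.Out-covered-v HG.Out-covered-e

    gιφL-v : ∀ w → vmap g (value (vmap (to ΦL.iso) w)) ≡ value w
    gιφL-v = ΦL.Fwd.factor-v g (λ _ → refl)
    gιφL-e : ∀ e → emap g (value (emap (to ΦL.iso) e)) ≡ value e
    gιφL-e = ΦL.Fwd.factor-e g (λ _ → refl)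
    hιφR-v : ∀ w → vmap h (value (vmap (to ΦR.iso) w)) ≡ value w
    hιφR-v = ΦR.Fwd.factor-v h (λ _ → refl)
    hιφR-e : ∀ e → emap h (value (emap (to ΦR.iso) e)) ≡ value e
    hιφR-e = ΦR.Fwd.factor-e h (λ _ → refl)

    -- Its vertices are !- or wire-vertices and its edges all
    -- leave !-vertices, so U(J) is edgeless; the conditions on β(J) and on
    -- !-boxes are inherited from G along the embedding g ∘ ι.
    private
      module FG = FiniteGraph G (IsBangGraph.finite bangG)

    J-finite : IsFinite T J
    J-finite = refinement-finite (proj₁ (IsBangGraph.finite bangD)) (λ y → FG.BoundP? (vmap g y))
             , refinement-finite (proj₂ (IsBangGraph.finite bangD))
                 (λ e → bang? _ ×-dec FG.BoundP? _ ×-dec FG.BoundP? _)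

    J-no-node : ∀ (v : V J) → ¬ isNodeT T (τV D (value v))
    J-no-node (y , [ p ]) isNode = ⊥-elim-irr (refute (BoundP⇒BoundR G _ p))
      where
      refute : BoundR G (vmap g y) → ⊥
      refute (inj₁ b) = bang⇒¬node _ (type-from g (isBangT T) y b) isNode
      refute (inj₂ (inj₁ (w , _))) = wire⇒¬node _ (type-from g (isWireT T) y w) isNode
      refute (inj₂ (inj₂ (w , _))) = wire⇒¬node _ (type-from g (isWireT T) y w) isNode

    UJ-edgeless : ¬ E (U T J)
    UJ-edgeless ((e , [ pe ]) , [ pu ]) = ⊥-elim-irr (proj₁ pu (proj₁ pe))

    UJ-string : IsStringGraph T (U T J)
    UJ-string = trivial-string-graph _ (λ { (_ , [ nb ]) → irrelevant-¬ nb })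
                  (λ v → J-no-node (value v)) UJ-edgeless

    UJ-sub-string : ∀ (P : V (U T J) → Set) → IsStringGraph T (fullSub T (U T J) P)
    UJ-sub-string P = trivial-string-graph _ (λ { ((_ , [ nb ]) , _) → irrelevant-¬ nb })
                    (λ v → J-no-node (value (value v))) (λ e → UJ-edgeless (value e))

    gι-mono : Mono T (g ∘ ι)
    gι-mono = (λ eq → value-injective (proj₁ mono-g eq)) , (λ eq → value-injective (proj₂ mono-g eq))

    J-lift : ∀ x y → IsBang T J x → EdgeRel T G (vmap (g ∘ ι) x) (vmap (g ∘ ι) y) → EdgeRel T J x y
    J-lift (a , [ pa ]) (b , [ pb ]) ba (e₀ , s≡ , t≡) =
      (e′ , [ subst (IsBang T D) (sym src≡a) ba , subst PJ (sym src≡a) pa , subst PJ (sym tgt≡b) pb ])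
      , value-injective src≡a , value-injective tgt≡b
      where
      pre : Σ[ e′ ∈ E D ] emap g e′ ≡ e₀
      pre = GH.bang-edge-preimage-irr e₀ (subst (IsBang T G) (sym s≡) (type-to g (isBangT T) a ba))
                                         (subst (BoundP T G) (sym t≡) pb)
      e′ : E D
      e′ = proj₁ pre
      src≡a : src D e′ ≡ a
      src≡a = proj₁ mono-g (trans (sym (src-pres g e′)) (trans (cong (src G) (proj₂ pre)) s≡))
      tgt≡b : tgt D e′ ≡ b
      tgt≡b = proj₁ mono-g (trans (sym (tgt-pres g e′)) (trans (cong (tgt G) (proj₂ pre)) t≡))

    module JG = ReflectBang (g ∘ ι) gι-mono J-lift

    J-bang-graph : IsBangGraph T J
    J-bang-graph = record
      { finite = J-finite
      ; string = UJ-string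
      ; posetal = JG.posetal-reflect (IsBangGraph.posetal bangG)
      ; open-B = λ b _ → record
          { string = UJ-sub-string _
          ; wire-closed-out = λ e → ⊥-elim (UJ-edgeless e)
          ; wire-closed-in = λ e → ⊥-elim (UJ-edgeless e)
          ; fixed-closed = λ e → ⊥-elim (UJ-edgeless e) }
      ; nested = JG.nested-reflect (IsBangGraph.nested bangG) }

    φ-match-v : ∀ (w : V (Bound! T G)) (w′ : V (Bound! T H)) →
                value w′ ≡ vmap h (value (vmap (to ΦL.iso) w)) → vmap (to ΦR.iso) w′ ≡ vmap (to ΦL.iso) w
    φ-match-v w w′ over = value-injective (proj₁ mono-h (trans (hιφR-v w′) over))

    φ-match-e : ∀ (e : E (Bound! T G)) (e′ : E (Bound! T H)) →
                value e′ ≡ emap h (value (emap (to ΦL.iso) e)) → emap (to ΦR.iso) e′ ≡ emap (to ΦL.iso) e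
    φ-match-e e e′ over = value-injective (proj₂ mono-h (trans (hιφR-e e′) over))

    -- j₂ ∘ φI = j₁ and k₂ ∘ φO = k₁, since φI and φO map over the same
    -- elements of D as φL
    j₂φI : ((to ΦR.iso ∘ InInclBound T H) ∘ to ΦI.iso) ≈ (to ΦL.iso ∘ InInclBound T G)
    j₂φI = (λ w → let w₀ = vmap (InInclBound T G) w in
                  φ-match-v w₀ (vmap (InInclBound T H) (vmap (to ΦI.iso) w))
                    (ΦI.Fwd.map-v-value w _ (gιφL-v w₀)))
         , (λ e → let e₀ = emap (InInclBound T G) e in
                  φ-match-e e₀ (emap (InInclBound T H) (emap (to ΦI.iso) e))
                    (ΦI.Fwd.map-e-value e _ (gιφL-e e₀)))

    k₂φO : ((to ΦR.iso ∘ OutInclBound T H) ∘ to ΦO.iso) ≈ (to ΦL.iso ∘ OutInclBound T G)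
    k₂φO = (λ w → let w₀ = vmap (OutInclBound T G) w in
                  φ-match-v w₀ (vmap (OutInclBound T H) (vmap (to ΦO.iso) w))
                    (ΦO.Fwd.map-v-value w _ (gιφL-v w₀)))
         , (λ e → let e₀ = emap (OutInclBound T G) e in
                  φ-match-e e₀ (emap (OutInclBound T H) (emap (to ΦO.iso) e))
                    (ΦO.Fwd.map-e-value e _ (gιφL-e e₀)))

    rewrite-rule : IsRewriteRule T (g ∘ ι) (h ∘ ι)
    rewrite-rule = record
      { bangL = bangG ; bangI = J-bang-graph ; bangR = bangH
      ; noIsoL = λ w _ → noIsoG w ; noIsoR = GH.no-isolated-H noIsoG
      ; φI = ΦI.iso ; φO = ΦO.iso ; φL = ΦL.iso ; φR = ΦR.iso
      ; i₁j₁ = (λ w → gιφL-v (vmap (InInclBound T G) w)) , (λ e → gιφL-e (emap (InInclBound T G) e))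
      ; i₂j₂ = (λ w → hιφR-v (vmap (InInclBound T H) w)) , (λ e → hιφR-e (emap (InInclBound T H) e))
      ; i₁k₁ = (λ w → gιφL-v (vmap (OutInclBound T G) w)) , (λ e → gιφL-e (emap (OutInclBound T G) e))
      ; i₂k₂ = (λ w → hιφR-v (vmap (OutInclBound T H) w)) , (λ e → hιφR-e (emap (OutInclBound T H) e))
      ; j₂φI = j₂φI
      ; k₂φO = k₂φO }

theorem5p14 : (T : Signature) {L I R G D H : TGraph T}
    (i₁ : Hom T I L) (i₂ : Hom T I R) (m : Hom T L G) (d : Hom T I D)
    (r : Hom T R H) (g : Hom T D G) (h : Hom T D H) →
    IsBangGraph T G → IsBangGraph T D → IsBangGraph T H →
    Mono T i₁ → Mono T i₂ → Mono T m → Mono T d → Mono T r → Mono T g → Mono T h →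
    _≈H_ T (_∘H_ T m i₁) (_∘H_ T g d) →
    _≈H_ T (_∘H_ T r i₂) (_∘H_ T h d) →
    IsPushout T i₁ d m g →
    IsPushout T i₂ d r h →
    IsRewriteRule T i₁ i₂ →
    NoIsolated T (U T G) →
    Σ[ J ∈ TGraph T ] Σ[ ι ∈ Hom T J D ]
      (Mono T ι × IsRewriteRule T (_∘H_ T g ι) (_∘H_ T h ι))
theorem5p14 T i₁ i₂ m d r g h bangG bangD bangH mono-i₁ mono-i₂ _ _ _ mono-g mono-h _ _ po₁ po₂ rule noIsoG =
  J , ι , ι-mono , rewrite-rule
  where
  open DoublePushout T i₁ i₂ m d r g h bangG bangD bangH mono-i₁ mono-i₂ mono-g mono-h po₁ po₂ rule noIsoG
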